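{- Let $a \geq 2$ be an integer. If $a$ is odd, then $G_{n,a} \equiv 1 \pmod{a}$ for every positive integer $n$. If $a$ is even, then for every integer $n \geq 2$, $G_{n,a} \equiv 1 \pmod{a}$ if $n$ is even and $G_{n,a} \equiv 1 + \frac{a}{2} \pmod{a}$ if $n$ is odd.
   Context: For an integer $a \geq 2$, the generalized Genocchi numbers $G_{n,a}$ ($n \geq 0$) are defined by $$\frac{a t}{e^{(a-1)t} + e^{(a-2)t} + \dots + e^t + 1} = \sum_{n=0}^{\infty} G_{n,a} \frac{t^n}{n!};$$ they are all integers. -}

module Defs where

open import Data.Nat as ℕ using (ℕ; zero; suc; _^_)
open import Data.Nat.Combinatorics using (_C_)
open import Data.Integer as ℤ using (ℤ; +_)
open import Data.Rational as ℚ using (ℚ; _/_; _+_; _-_; _*_)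
open import Data.Fin using (Fin; toℕ)
open import Data.Vec using (Vec; []; _∷ʳ_; lookup)
open import Data.List using (List; map; upTo; allFin)
open import Data.Nat.ListAction using (sum)
import Data.List as L

-- power sum  S(a,m) = Σ_{j=0}^{a-1} j^m   (with 0^0 = 1)
powSum : ℕ → ℕ → ℕ
powSum a m = sum (map (λ j → j ^ m) (upTo a))

δ₁ : ℕ → ℚ
δ₁ 1 = ℚ.1ℚ
δ₁ _ = ℚ.0ℚ

-- Comparing coefficients of t^n/n! in
--   G(t) · (e^{(a-1)t} + … + e^t + 1) = a t,
-- where e^{(a-1)t}+…+1 = Σ_m powSum a m · t^m/m!, gives
--   Σ_{k=0}^{n} C(n,k) G_k powSum a (n-k) = a·[n = 1],
-- and since powSum a 0 = a, for a ≥ 1: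
--   G_n = [n=1] - (1/a) Σ_{k<n} C(n,k) G_k powSum a (n-k).
-- genVec a n = (G_{0,a}, …, G_{n-1,a}).  (a = 0 is junk.)
genVec : ℕ → (n : ℕ) → Vec ℚ n
genVec zero    n       = Data.Vec.replicate n ℚ.0ℚ
genVec (suc b) zero    = []
genVec (suc b) (suc n) = prev ∷ʳ next
  where
    prev : Vec ℚ n
    prev = genVec (suc b) n
    term : Fin n → ℚ
    term k = ((+ (n C toℕ k)) / 1) * lookup prev k * ((+ powSum (suc b) (n ℕ.∸ toℕ k)) / 1)
    next : ℚ
    next = δ₁ n - (sum' (L.map term (allFin n))) * ((+ 1) / suc b)
      where
        sum' : List ℚ → ℚ
        sum' = L.foldr _+_ ℚ.0ℚ

G : (n a : ℕ) → ℚ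
G n a = lookup (genVec a (suc n)) (Data.Fin.fromℕ n)

import Data.Vec
import Data.Fin

-- With S(t) = Σ_{j<a} e^{jt} the definition reads G(t) S(t) = a t, and as (e^t − 1) S(t) = e^{at} − 1,
-- also G(t) (e^{at} − 1) = a t (e^t − 1); coefficientwise, Σ_{k<n} C(n,k) a^{n−k} G_k = a n for n ≥ 2,
-- and passing from one identity to the other is associativity of the binomial convolution.
-- Let ℤ₍ₐ₎ be the ring of rationals whose denominators are coprime to a. For n = m + 1 ≥ 3 every term
-- with k ≤ m − 2 lies in n a² ℤ₍ₐ₎, since j ∣ c a^{j−2} for some c coprime to a when j ≥ 3. Dividing
-- by n a leaves G_m ≡ 1 − m (a/2) G_{m−1} modulo a ℤ₍ₐ₎. As a G_m ∈ ℤ by G(t) S(t) = a t, strong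
-- induction makes every G_m an integer, and the congruence then holds in ℤ. For odd a the term
-- m (a/2) G_{m−1} vanishes modulo a; for even a, G_{m−1} ≡ 1 + (m − 1) a/2 turns it into m a/2,
-- which is 0 or a/2 according to the parity of m.

module Submission where

open import Algebra.Bundles using (CommutativeSemiring)
open import Data.Nat.Base as ℕ using (ℕ; zero; suc; _≤_; _<_; _∸_; s≤s; z≤n)
open import Data.Nat.Combinatorics using (_C_)
open import Data.Integer.Base as ℤ using (ℤ)
open import Data.Rational.Base as ℚ using (ℚ)
open import Data.Product using (∃; ∃₂; _,_; proj₁; proj₂)
open import Function using (_∘_)
open import Relation.Binary.PropositionalEquality as ≡ using (_≡_)
open import Defs

-- Binomial coefficients

module _ where
  open import Data.Nat.Base
  open import Data.Nat.Properties
  open import Data.Nat.Combinatorics using (_C_; nCk≡n!/k![n-k]!; k![n∸k]!∣n!; nCk≡nC[n∸k]; nC1≡n)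
  open import Data.Nat.DivMod using (m/n*n≡m)
  open import Data.Nat.Tactic.RingSolver using (solve-∀)
  open import Relation.Binary.PropositionalEquality
  open ≡-Reasoning

  nCk*k![n∸k]!≡n! : ∀ {n k} → k ≤ n → (n C k) * (k ! * (n ∸ k) !) ≡ n !
  nCk*k![n∸k]!≡n! {n} {k} k≤n = trans
    (cong (_* (k ! * (n ∸ k) !)) (nCk≡n!/k![n-k]! k≤n))
    (m/n*n≡m {{k !* (n ∸ k) !≢0}} (k![n∸k]!∣n! k≤n))

  nC[k+i]*[k+i]Ck≡nCk*[n∸k]Ci : ∀ {n} k i → k + i ≤ n →
    (n C (k + i)) * ((k + i) C k) ≡ (n C k) * ((n ∸ k) C i)
  nC[k+i]*[k+i]Ck≡nCk*[n∸k]Ci {n} k i k+i≤n =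
    *-cancelʳ-≡ _ _ (k ! * (i ! * (n ∸ k ∸ i) !)) {{k!i![n∸k∸i]!≢0}} (trans viaK+i (sym viaK))
    where
    k!i![n∸k∸i]!≢0 : NonZero (k ! * (i ! * (n ∸ k ∸ i) !))
    k!i![n∸k∸i]!≢0 = m*n≢0 (k !) _ {{k !≢0}} {{i !* (n ∸ k ∸ i) !≢0}}
    rearrange₁ : ∀ A B x y z → A * B * (x * (y * z)) ≡ A * (B * (x * y) * z)
    rearrange₁ = solve-∀
    rearrange₂ : ∀ A B x y z → A * B * (x * (y * z)) ≡ A * (x * (B * (y * z)))
    rearrange₂ = solve-∀
    k≤n : k ≤ n
    k≤n = ≤-trans (m≤m+n k i) k+i≤n
    i≤n∸k : i ≤ n ∸ k
    i≤n∸k = subst (_≤ n ∸ k) (m+n∸m≡n k i) (∸-monoˡ-≤ k k+i≤n)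
    viaK+i : (n C (k + i)) * ((k + i) C k) * (k ! * (i ! * (n ∸ k ∸ i) !)) ≡ n !
    viaK+i = begin
      (n C (k + i)) * ((k + i) C k) * (k ! * (i ! * (n ∸ k ∸ i) !))
        ≡⟨ rearrange₁ (n C (k + i)) ((k + i) C k) (k !) (i !) ((n ∸ k ∸ i) !) ⟩
      (n C (k + i)) * (((k + i) C k) * (k ! * i !) * (n ∸ k ∸ i) !)
        ≡⟨ cong₂ (λ u v → (n C (k + i)) * (((k + i) C k) * (k ! * u !) * v !)) (sym (m+n∸m≡n k i)) (∸-+-assoc n k i) ⟩
      (n C (k + i)) * (((k + i) C k) * (k ! * (k + i ∸ k) !) * (n ∸ (k + i)) !)
        ≡⟨ cong (λ u → (n C (k + i)) * (u * (n ∸ (k + i)) !)) (nCk*k![n∸k]!≡n! (m≤m+n k i)) ⟩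
      (n C (k + i)) * ((k + i) ! * (n ∸ (k + i)) !)
        ≡⟨ nCk*k![n∸k]!≡n! k+i≤n ⟩
      n ! ∎
    viaK : (n C k) * ((n ∸ k) C i) * (k ! * (i ! * (n ∸ k ∸ i) !)) ≡ n !
    viaK = begin
      (n C k) * ((n ∸ k) C i) * (k ! * (i ! * (n ∸ k ∸ i) !))
        ≡⟨ rearrange₂ (n C k) ((n ∸ k) C i) (k !) (i !) ((n ∸ k ∸ i) !) ⟩
      (n C k) * (k ! * (((n ∸ k) C i) * (i ! * (n ∸ k ∸ i) !)))
        ≡⟨ cong (λ u → (n C k) * (k ! * u)) (nCk*k![n∸k]!≡n! i≤n∸k) ⟩
      (n C k) * (k ! * (n ∸ k) !)
        ≡⟨ nCk*k![n∸k]!≡n! k≤n ⟩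
      n ! ∎

  [1+n]Ck*[1+n∸k]≡[1+n]*nCk : ∀ {n k} → k ≤ n → (suc n C k) * (suc n ∸ k) ≡ suc n * (n C k)
  [1+n]Ck*[1+n∸k]≡[1+n]*nCk {n} {k} k≤n =
    *-cancelʳ-≡ _ _ (k ! * (n ∸ k) !) {{k !* (n ∸ k) !≢0}} (trans viaSuc (sym viaN))
    where
    rearrange : ∀ A t x y → A * t * (x * y) ≡ A * (x * (t * y))
    rearrange = solve-∀
    viaSuc : (suc n C k) * (suc n ∸ k) * (k ! * (n ∸ k) !) ≡ suc n !
    viaSuc = begin
      (suc n C k) * (suc n ∸ k) * (k ! * (n ∸ k) !)
        ≡⟨ rearrange (suc n C k) (suc n ∸ k) (k !) ((n ∸ k) !) ⟩
      (suc n C k) * (k ! * ((suc n ∸ k) * (n ∸ k) !))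
        ≡⟨ cong (λ u → (suc n C k) * (k ! * (u * (n ∸ k) !))) (+-∸-assoc 1 k≤n) ⟩
      (suc n C k) * (k ! * suc (n ∸ k) !)
        ≡⟨ cong (λ u → (suc n C k) * (k ! * u !)) (+-∸-assoc 1 k≤n) ⟨
      (suc n C k) * (k ! * (suc n ∸ k) !)
        ≡⟨ nCk*k![n∸k]!≡n! (m≤n⇒m≤1+n k≤n) ⟩
      suc n ! ∎
    viaN : suc n * (n C k) * (k ! * (n ∸ k) !) ≡ suc n !
    viaN = trans (*-assoc (suc n) (n C k) _) (cong (suc n *_) (nCk*k![n∸k]!≡n! k≤n))

  [1+n]Cn≡1+n : ∀ n → (suc n C n) ≡ suc n
  [1+n]Cn≡1+n n = begin
    suc n C n             ≡⟨ nCk≡nC[n∸k] (n≤1+n n) ⟩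
    suc n C (suc n ∸ n)   ≡⟨ cong (suc n C_) (m+n∸n≡m 1 n) ⟩
    suc n C 1             ≡⟨ nC1≡n (suc n) ⟩
    suc n                 ∎

  [2+n]Cn*2≡[2+n]*[1+n] : ∀ n → (suc (suc n) C n) * 2 ≡ suc (suc n) * suc n
  [2+n]Cn*2≡[2+n]*[1+n] n = *-cancelʳ-≡ _ _ (n !) {{n !≢0}} (begin
    (suc (suc n) C n) * 2 * n !                       ≡⟨ *-assoc (suc (suc n) C n) 2 (n !) ⟩
    (suc (suc n) C n) * (2 * n !)                     ≡⟨ cong ((suc (suc n) C n) *_) (*-comm 2 (n !)) ⟩
    (suc (suc n) C n) * (n ! * 2 !)                   ≡⟨ cong (λ u → (suc (suc n) C n) * (n ! * u !)) (m+n∸n≡m 2 n) ⟨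
    (suc (suc n) C n) * (n ! * (suc (suc n) ∸ n) !)   ≡⟨ nCk*k![n∸k]!≡n! (m≤n+m n 2) ⟩
    suc (suc n) !                                   ≡⟨ *-assoc (suc (suc n)) (suc n) (n !) ⟨
    suc (suc n) * suc n * n !                       ∎)

-- Finite sums and binomial convolution

module FiniteSums {c ℓ} (R : CommutativeSemiring c ℓ) where

  open CommutativeSemiring R
  open import Algebra.Properties.Semiring.Sum semiring
    using (sum; sum-cong-≋; sum-replicate-zero; ∑-distrib-+; ∑-comm; *-distribˡ-sum; *-distribʳ-sum)
  open import Algebra.Properties.Semiring.Mult semiring using (_×_; ×-congʳ)
  open import Algebra.Properties.CommutativeMonoid.Mult +-commutativeMonoid using (×-distrib-+)
  open import Algebra.Properties.Semiring.Exp semiring using (_^_)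
  open import Algebra.Properties.CommutativeSemiring.Binomial R using (theorem)
  open import Data.Fin.Base as Fin using (Fin; toℕ)
  import Data.List.Base as List
  open import Data.Fin.Properties using (toℕ<n)
  open import Relation.Binary.Reasoning.Setoid setoid

  -- Opaque, so that summands are inferred from goals instead of from the unfolded Fin-indexed sum.
  opaque
    Σ< : ℕ → (ℕ → Carrier) → Carrier
    Σ< n f = sum {n} (f ∘ toℕ)

    Σ<-empty : ∀ f → Σ< 0 f ≈ 0#
    Σ<-empty f = refl

    Σ<-suc : ∀ n f → Σ< (suc n) f ≈ f 0 + Σ< n (f ∘ suc)
    Σ<-suc n f = refl

    Σ<-cong : ∀ n {f g} → (∀ {k} → k < n → f k ≈ g k) → Σ< n f ≈ Σ< n g
    Σ<-cong n f≈g = sum-cong-≋ (λ i → f≈g (toℕ<n i))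

    Σ<-distrib-+ : ∀ n f g → Σ< n (λ k → f k + g k) ≈ Σ< n f + Σ< n g
    Σ<-distrib-+ n f g = ∑-distrib-+ {n} (f ∘ toℕ) (g ∘ toℕ)

    *-distribˡ-Σ< : ∀ x n f → x * Σ< n f ≈ Σ< n (λ k → x * f k)
    *-distribˡ-Σ< x n f = *-distribˡ-sum {n} x (f ∘ toℕ)

    *-distribʳ-Σ< : ∀ x n f → Σ< n f * x ≈ Σ< n (λ k → f k * x)
    *-distribʳ-Σ< x n f = *-distribʳ-sum {n} x (f ∘ toℕ)

    Σ<-comm : ∀ m n (F : ℕ → ℕ → Carrier) → Σ< m (λ i → Σ< n (F i)) ≈ Σ< n (λ j → Σ< m (λ i → F i j))
    Σ<-comm m n F = ∑-comm {m} {n} (λ i j → F (toℕ i) (toℕ j))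

    Σ<-vanishing : ∀ n f → (∀ {k} → k < n → f k ≈ 0#) → Σ< n f ≈ 0#
    Σ<-vanishing n f f≈0 = trans (Σ<-cong n f≈0) (sum-replicate-zero n)

    binomial-theorem : ∀ n x y → Σ< (suc n) (λ k → (n C k) × (x ^ k * y ^ (n ∸ k))) ≈ (x + y) ^ n
    binomial-theorem n x y = sym (theorem n x y)

  Σ<-last : ∀ n f → Σ< (suc n) f ≈ Σ< n f + f n
  Σ<-last zero    f = begin
    Σ< 1 f          ≈⟨ Σ<-suc 0 f ⟩
    f 0 + Σ< 0 _    ≈⟨ +-congˡ (Σ<-empty _) ⟩
    f 0 + 0#        ≈⟨ +-comm (f 0) 0# ⟩
    0# + f 0        ≈⟨ +-congʳ (Σ<-empty f) ⟨
    Σ< 0 f + f 0    ∎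
  Σ<-last (suc n) f = begin
    Σ< (suc (suc n)) f                 ≈⟨ Σ<-suc (suc n) f ⟩
    f 0 + Σ< (suc n) (f ∘ suc)         ≈⟨ +-congˡ (Σ<-last n (f ∘ suc)) ⟩
    f 0 + (Σ< n (f ∘ suc) + f (suc n)) ≈⟨ +-assoc (f 0) _ _ ⟨
    (f 0 + Σ< n (f ∘ suc)) + f (suc n) ≈⟨ +-congʳ (Σ<-suc n f) ⟨
    Σ< (suc n) f + f (suc n)           ∎

  Σ<-closed : ∀ {p} (P : Carrier → Set p) → (∀ {x y} → x ≈ y → P x → P y) → P 0# →
              (∀ {x y} → P x → P y → P (x + y)) →
              ∀ n {f} → (∀ {k} → k < n → P (f k)) → P (Σ< n f)
  Σ<-closed P resp P0 P+ zero    {f} Pf = resp (sym (Σ<-empty f)) P0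
  Σ<-closed P resp P0 P+ (suc n) {f} Pf =
    resp (sym (Σ<-suc n f)) (P+ (Pf (s≤s z≤n)) (Σ<-closed P resp P0 P+ n (Pf ∘ s≤s)))

  ×-zeroʳ : ∀ m → m × 0# ≈ 0#
  ×-zeroʳ zero    = refl
  ×-zeroʳ (suc m) = trans (+-identityˡ _) (×-zeroʳ m)

  ×-distrib-Σ< : ∀ m n f → m × Σ< n f ≈ Σ< n (λ k → m × f k)
  ×-distrib-Σ< m zero    f = trans (×-congʳ m (Σ<-empty f)) (trans (×-zeroʳ m) (sym (Σ<-empty _)))
  ×-distrib-Σ< m (suc n) f = begin
    m × Σ< (suc n) f                ≈⟨ ×-congʳ m (Σ<-suc n f) ⟩
    m × (f 0 + Σ< n (f ∘ suc))      ≈⟨ ×-distrib-+ (f 0) _ m ⟩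
    m × f 0 + m × Σ< n (f ∘ suc)    ≈⟨ +-congˡ (×-distrib-Σ< m n (f ∘ suc)) ⟩
    m × f 0 + Σ< n (λ k → m × f (suc k)) ≈⟨ Σ<-suc n (λ k → m × f k) ⟨
    Σ< (suc n) (λ k → m × f k)      ∎

  foldr-tabulate : ∀ n (t : Fin n → Carrier) f → (∀ i → t i ≈ f (toℕ i)) →
                   List.foldr _+_ 0# (List.tabulate t) ≈ Σ< n f
  foldr-tabulate zero    t f t≈f = sym (Σ<-empty f)
  foldr-tabulate (suc n) t f t≈f =
    trans (+-cong (t≈f Fin.zero) (foldr-tabulate n (t ∘ Fin.suc) (f ∘ suc) (t≈f ∘ Fin.suc))) (sym (Σ<-suc n f))

  foldr-map-applyUpTo : ∀ n (f : ℕ → ℕ) (g : ℕ → Carrier) →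
                        List.foldr _+_ 0# (List.map g (List.applyUpTo f n)) ≈ Σ< n (g ∘ f)
  foldr-map-applyUpTo zero    f g = sym (Σ<-empty (g ∘ f))
  foldr-map-applyUpTo (suc n) f g =
    trans (+-congˡ (foldr-map-applyUpTo n (f ∘ suc) g)) (sym (Σ<-suc n (g ∘ f)))

  Σ<-triangle : ∀ n (F : ℕ → ℕ → Carrier) →
    Σ< (suc n) (λ m → Σ< (suc m) (F m)) ≈ Σ< (suc n) (λ k → Σ< (suc (n ∸ k)) (λ i → F (k ℕ.+ i) k))
  Σ<-triangle zero    F = Σ<-cong 1 (λ { (s≤s z≤n) → Σ<-cong 1 (λ { (s≤s z≤n) → refl }) })
  Σ<-triangle (suc n) F = begin
    Σ< (suc (suc n)) (λ m → Σ< (suc m) (F m))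
      ≈⟨ Σ<-suc (suc n) _ ⟩
    Σ< 1 (F 0) + Σ< (suc n) (λ m → Σ< (suc (suc m)) (F (suc m)))
      ≈⟨ +-cong (trans (Σ<-suc 0 (F 0)) (trans (+-congˡ (Σ<-empty _)) (+-identityʳ _))) (Σ<-cong (suc n) (λ {m} _ → Σ<-suc (suc m) (F (suc m)))) ⟩
    F 0 0 + Σ< (suc n) (λ m → F (suc m) 0 + Σ< (suc m) (λ k → F (suc m) (suc k)))
      ≈⟨ +-congˡ (Σ<-distrib-+ (suc n) (λ m → F (suc m) 0) (λ m → Σ< (suc m) (λ k → F (suc m) (suc k)))) ⟩
    F 0 0 + (Σ< (suc n) (λ m → F (suc m) 0) + Σ< (suc n) (λ m → Σ< (suc m) (λ k → F (suc m) (suc k))))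
      ≈⟨ +-congˡ (+-congˡ (Σ<-triangle n (λ m k → F (suc m) (suc k)))) ⟩
    F 0 0 + (Σ< (suc n) (λ i → F (suc i) 0) + Σ< (suc n) (λ k → Σ< (suc (n ∸ k)) (λ i → F (suc k ℕ.+ i) (suc k))))
      ≈⟨ +-assoc (F 0 0) _ _ ⟨
    (F 0 0 + Σ< (suc n) (λ i → F (suc i) 0)) + Σ< (suc n) (λ k → Σ< (suc (n ∸ k)) (λ i → F (suc k ℕ.+ i) (suc k)))
      ≈⟨ +-congʳ (Σ<-suc (suc n) (λ i → F i 0)) ⟨
    Σ< (suc (suc n)) (λ i → F i 0) + Σ< (suc n) (λ k → Σ< (suc (n ∸ k)) (λ i → F (suc k ℕ.+ i) (suc k)))
      ≈⟨ Σ<-suc (suc n) (λ k → Σ< (suc (suc n ∸ k)) (λ i → F (k ℕ.+ i) k)) ⟨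
    Σ< (suc (suc n)) (λ k → Σ< (suc (suc n ∸ k)) (λ i → F (k ℕ.+ i) k)) ∎

module BinomialConvolution {c ℓ} (R : CommutativeSemiring c ℓ) where

  open CommutativeSemiring R
  open FiniteSums R
  open import Algebra.Properties.Semiring.Mult semiring using (_×_; ×-congʳ; ×-congˡ; ×-homo-1; ×-assoc-*; ×-comm-*; ×-assocˡ)
  import Data.Nat.Properties as ℕ
  open import Data.Nat.Combinatorics using (nCn≡1)
  open import Relation.Binary.Reasoning.Setoid setoid

  infixl 7 _⋆_

  _⋆_ : (ℕ → Carrier) → (ℕ → Carrier) → ℕ → Carrier
  (f ⋆ g) n = Σ< (suc n) λ k → (n C k) × f k * g (n ∸ k)

  δ₀ : ℕ → Carrier
  δ₀ zero    = 1#
  δ₀ (suc _) = 0#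

  ⋆-congˡ : ∀ {f f′} g → (∀ k → f k ≈ f′ k) → ∀ n → (f ⋆ g) n ≈ (f′ ⋆ g) n
  ⋆-congˡ g f≈f′ n = Σ<-cong (suc n) (λ {k} _ → *-congʳ (×-congʳ (n C k) (f≈f′ k)))

  ⋆-congʳ : ∀ f {g g′} → (∀ k → g k ≈ g′ k) → ∀ n → (f ⋆ g) n ≈ (f ⋆ g′) n
  ⋆-congʳ f g≈g′ n = Σ<-cong (suc n) (λ {k} _ → *-congˡ (g≈g′ (n ∸ k)))

  ⋆-distribˡ-+ : ∀ f g h n → (f ⋆ (λ k → g k + h k)) n ≈ (f ⋆ g) n + (f ⋆ h) n
  ⋆-distribˡ-+ f g h n = trans
    (Σ<-cong (suc n) (λ {k} _ → distribˡ ((n C k) × f k) (g (n ∸ k)) (h (n ∸ k))))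
    (Σ<-distrib-+ (suc n) (λ k → (n C k) × f k * g (n ∸ k)) (λ k → (n C k) × f k * h (n ∸ k)))

  ⋆-identityʳ : ∀ f n → (f ⋆ δ₀) n ≈ f n
  ⋆-identityʳ f n = begin
    (f ⋆ δ₀) n                 ≈⟨ Σ<-last n term ⟩
    Σ< n term + term n         ≈⟨ +-cong (Σ<-vanishing n term off-diagonal) diagonal ⟩
    0# + f n                   ≈⟨ +-identityˡ (f n) ⟩
    f n                        ∎
    where
    term : ℕ → Carrier
    term k = (n C k) × f k * δ₀ (n ∸ k)
    off-diagonal : ∀ {k} → k < n → term k ≈ 0#
    off-diagonal {k} k<n = trans (*-congˡ (reflexive (≡.cong δ₀ (ℕ.+-∸-assoc 1 k<n)))) (zeroʳ _)
    diagonal : term n ≈ f n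
    diagonal = begin
      (n C n) × f n * δ₀ (n ∸ n) ≈⟨ *-cong (×-congˡ (nCn≡1 n)) (reflexive (≡.cong δ₀ (ℕ.n∸n≡0 n))) ⟩
      1 × f n * 1#               ≈⟨ *-identityʳ (1 × f n) ⟩
      1 × f n                    ≈⟨ ×-homo-1 (f n) ⟩
      f n                        ∎

  private
    ×-*-assoc₁ : ∀ p q x y z → p × (q × x * y) * z ≈ (p ℕ.* q) × (x * (y * z))
    ×-*-assoc₁ p q x y z = begin
      p × (q × x * y) * z     ≈⟨ ×-assoc-* p _ z ⟩
      p × (q × x * y * z)     ≈⟨ ×-congʳ p (*-assoc _ y z) ⟩
      p × (q × x * (y * z))   ≈⟨ ×-congʳ p (×-assoc-* q x _) ⟩
      p × (q × (x * (y * z))) ≈⟨ ×-assocˡ _ p q ⟩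
      (p ℕ.* q) × (x * (y * z)) ∎

    ×-*-assoc₂ : ∀ p q x y z → p × x * (q × y * z) ≈ (p ℕ.* q) × (x * (y * z))
    ×-*-assoc₂ p q x y z = begin
      p × x * (q × y * z)     ≈⟨ ×-assoc-* p x _ ⟩
      p × (x * (q × y * z))   ≈⟨ ×-congʳ p (*-congˡ (×-assoc-* q y z)) ⟩
      p × (x * q × (y * z))   ≈⟨ ×-congʳ p (×-comm-* q x _) ⟩
      p × (q × (x * (y * z))) ≈⟨ ×-assocˡ _ p q ⟩
      (p ℕ.* q) × (x * (y * z)) ∎

  ⋆-assoc : ∀ f g h n → ((f ⋆ g) ⋆ h) n ≈ (f ⋆ (g ⋆ h)) n
  ⋆-assoc f g h n = begin
    ((f ⋆ g) ⋆ h) n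
      ≈⟨ Σ<-cong (suc n) (λ {m} _ → distribute m) ⟩
    Σ< (suc n) (λ m → Σ< (suc m) (F m))
      ≈⟨ Σ<-triangle n F ⟩
    Σ< (suc n) (λ k → Σ< (suc (n ∸ k)) (λ i →
      (n C (k ℕ.+ i)) × (((k ℕ.+ i) C k) × f k * g (k ℕ.+ i ∸ k)) * h (n ∸ (k ℕ.+ i))))
      ≈⟨ Σ<-cong (suc n) (λ {k} k<1+n → Σ<-cong (suc (n ∸ k)) (λ i<1+n∸k → regroup (ℕ.≤-pred k<1+n) (ℕ.≤-pred i<1+n∸k))) ⟩
    Σ< (suc n) (λ k → Σ< (suc (n ∸ k)) (λ i → (n C k) × f k * (((n ∸ k) C i) × g i * h (n ∸ k ∸ i))))
      ≈⟨ Σ<-cong (suc n) (λ {k} _ → *-distribˡ-Σ< ((n C k) × f k) (suc (n ∸ k)) (λ i → ((n ∸ k) C i) × g i * h (n ∸ k ∸ i))) ⟨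
    (f ⋆ (g ⋆ h)) n ∎
    where
    F : ℕ → ℕ → Carrier
    F m k = (n C m) × ((m C k) × f k * g (m ∸ k)) * h (n ∸ m)
    distribute : ∀ m → (n C m) × (f ⋆ g) m * h (n ∸ m) ≈ Σ< (suc m) (F m)
    distribute m = trans
      (*-congʳ (×-distrib-Σ< (n C m) (suc m) (λ k → (m C k) × f k * g (m ∸ k))))
      (*-distribʳ-Σ< (h (n ∸ m)) (suc m) (λ k → (n C m) × ((m C k) × f k * g (m ∸ k))))
    regroup : ∀ {k i} → k ≤ n → i ≤ n ∸ k →
      (n C (k ℕ.+ i)) × (((k ℕ.+ i) C k) × f k * g (k ℕ.+ i ∸ k)) * h (n ∸ (k ℕ.+ i)) ≈
      (n C k) × f k * (((n ∸ k) C i) × g i * h (n ∸ k ∸ i))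
    regroup {k} {i} k≤n i≤n∸k = begin
      (n C (k ℕ.+ i)) × (((k ℕ.+ i) C k) × f k * g (k ℕ.+ i ∸ k)) * h (n ∸ (k ℕ.+ i))
        ≈⟨ ×-*-assoc₁ (n C (k ℕ.+ i)) ((k ℕ.+ i) C k) (f k) (g (k ℕ.+ i ∸ k)) (h (n ∸ (k ℕ.+ i))) ⟩
      ((n C (k ℕ.+ i)) ℕ.* ((k ℕ.+ i) C k)) × (f k * (g (k ℕ.+ i ∸ k) * h (n ∸ (k ℕ.+ i))))
        ≡⟨ ≡.cong₂ (λ u v → u × (f k * v))
             (nC[k+i]*[k+i]Ck≡nCk*[n∸k]Ci k i k+i≤n)
             (≡.cong₂ (λ u v → g u * h v) (ℕ.m+n∸m≡n k i) (≡.sym (ℕ.∸-+-assoc n k i))) ⟩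
      ((n C k) ℕ.* ((n ∸ k) C i)) × (f k * (g i * h (n ∸ k ∸ i)))
        ≈⟨ ×-*-assoc₂ (n C k) ((n ∸ k) C i) (f k) (g i) (h (n ∸ k ∸ i)) ⟨
      (n C k) × f k * (((n ∸ k) C i) × g i * h (n ∸ k ∸ i)) ∎
      where
      k+i≤n : k ℕ.+ i ≤ n
      k+i≤n = ≡.subst (k ℕ.+ i ≤_) (ℕ.m+[n∸m]≡n k≤n) (ℕ.+-monoʳ-≤ k i≤n∸k)

-- Power sums

module _ where
  open import Relation.Binary.PropositionalEquality
  open import Data.Nat.Base
  open import Data.Nat.Properties
  open import Algebra.Properties.Semiring.Mult +-*-semiring using () renaming (_×_ to _×′_)
  open import Algebra.Properties.Semiring.Exp +-*-semiring using () renaming (_^_ to _^′_)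
  open FiniteSums +-*-commutativeSemiring renaming (Σ< to Σℕ<)
  open ≡-Reasoning

  ×′≡* : ∀ m n → m ×′ n ≡ m * n
  ×′≡* zero    n = refl
  ×′≡* (suc m) n = cong (n +_) (×′≡* m n)

  ^′≡^ : ∀ m n → m ^′ n ≡ m ^ n
  ^′≡^ m zero    = refl
  ^′≡^ m (suc n) = cong (m *_) (^′≡^ m n)

  Σ[nCk*x^k]≡[1+x]^n : ∀ n x → Σℕ< (suc n) (λ k → (n C k) * x ^ k) ≡ suc x ^ n
  Σ[nCk*x^k]≡[1+x]^n n x = begin
    Σℕ< (suc n) (λ k → (n C k) * x ^ k)                          ≡⟨ Σ<-cong (suc n) (λ {k} _ → sym (term k)) ⟩
    Σℕ< (suc n) (λ k → (n C k) ×′ (x ^′ k * 1 ^′ (n ∸ k)))        ≡⟨ binomial-theorem n x 1 ⟩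
    (x + 1) ^′ n                                                 ≡⟨ ^′≡^ (x + 1) n ⟩
    (x + 1) ^ n                                                  ≡⟨ cong (_^ n) (+-comm x 1) ⟩
    suc x ^ n                                                    ∎
    where
    term : ∀ k → (n C k) ×′ (x ^′ k * 1 ^′ (n ∸ k)) ≡ (n C k) * x ^ k
    term k = begin
      (n C k) ×′ (x ^′ k * 1 ^′ (n ∸ k))
        ≡⟨ ×′≡* (n C k) _ ⟩
      (n C k) * (x ^′ k * 1 ^′ (n ∸ k))
        ≡⟨ cong₂ (λ u v → (n C k) * (u * v)) (^′≡^ x k) (trans (^′≡^ 1 (n ∸ k)) (^-zeroˡ (n ∸ k))) ⟩
      (n C k) * (x ^ k * 1)
        ≡⟨ cong ((n C k) *_) (*-identityʳ (x ^ k)) ⟩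
      (n C k) * x ^ k                    ∎

  powSum≡Σ< : ∀ a m → powSum a m ≡ Σℕ< a (λ j → j ^ m)
  powSum≡Σ< a m = foldr-map-applyUpTo a (λ j → j) (_^ m)

  -- The coefficients of t^m/m! in e^t S(t) + 1 = S(t) + e^{at}.
  Σ[mCk*powSum[k]]+0^m≡powSum[m]+a^m : ∀ a m →
    Σℕ< (suc m) (λ k → (m C k) * powSum a k) + 0 ^ m ≡ powSum a m + a ^ m
  Σ[mCk*powSum[k]]+0^m≡powSum[m]+a^m a m = begin
    Σℕ< (suc m) (λ k → (m C k) * powSum a k) + 0 ^ m
      ≡⟨ cong (_+ 0 ^ m) (Σ<-cong (suc m) (λ {k} _ → cong ((m C k) *_) (powSum≡Σ< a k))) ⟩
    Σℕ< (suc m) (λ k → (m C k) * Σℕ< a (λ j → j ^ k)) + 0 ^ m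
      ≡⟨ cong (_+ 0 ^ m) (Σ<-cong (suc m) (λ {k} _ → *-distribˡ-Σ< (m C k) a (λ j → j ^ k))) ⟩
    Σℕ< (suc m) (λ k → Σℕ< a (λ j → (m C k) * j ^ k)) + 0 ^ m
      ≡⟨ cong (_+ 0 ^ m) (Σ<-comm (suc m) a (λ k j → (m C k) * j ^ k)) ⟩
    Σℕ< a (λ j → Σℕ< (suc m) (λ k → (m C k) * j ^ k)) + 0 ^ m
      ≡⟨ cong (_+ 0 ^ m) (Σ<-cong a (λ {j} _ → Σ[nCk*x^k]≡[1+x]^n m j)) ⟩
    Σℕ< a (λ j → suc j ^ m) + 0 ^ m
      ≡⟨ +-comm _ (0 ^ m) ⟩
    0 ^ m + Σℕ< a (λ j → suc j ^ m)
      ≡⟨ Σ<-suc a (_^ m) ⟨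
    Σℕ< (suc a) (_^ m)
      ≡⟨ Σ<-last a (_^ m) ⟩
    Σℕ< a (_^ m) + a ^ m
      ≡⟨ cong (_+ a ^ m) (powSum≡Σ< a m) ⟨
    powSum a m + a ^ m ∎

-- Divisibility up to factors coprime to a

module _ where
  open import Data.Product using (_×_)
  open import Data.Nat.Base
  open import Data.Nat.Properties
  open import Data.Nat.Divisibility
  open import Data.Nat.Coprimality using (Coprime; coprime?; coprime-divisor; gcd≡1⇒coprime)
  open import Data.Nat.GCD using (gcd; gcd[m,n]∣m; gcd[m,n]∣n; gcd[m,n]≢0)
  open import Data.Nat.Primality using (irreducible[2])
  open import Data.Nat.Induction using (<-rec)
  open import Data.Nat.DivMod using (_%_; _/_; m%n<n; m≡m%n+[m/n]*n)
  open import Data.Nat.Combinatorics using (_C_)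
  open import Data.Nat.Tactic.RingSolver using (solve-∀)
  open import Data.Sum using (inj₁; inj₂)
  open import Relation.Nullary using (¬_; yes; no; contradiction)
  open import Relation.Binary.PropositionalEquality

  coprime-* : ∀ {m n o} → Coprime m o → Coprime n o → Coprime (m * n) o
  coprime-* {m} m⊥o n⊥o {d} (d∣mn , d∣o) = n⊥o (coprime-divisor d⊥m d∣mn , d∣o)
    where
    d⊥m : Coprime d m
    d⊥m (e∣d , e∣m) = m⊥o (e∣m , ∣-trans e∣d d∣o)

  ∤⇒coprime-2 : ∀ {n} → ¬ 2 ∣ n → Coprime 2 n
  ∤⇒coprime-2 2∤n (d∣2 , d∣n) with irreducible[2] d∣2
  ... | inj₁ d≡1 = d≡1
  ... | inj₂ refl = contradiction d∣n 2∤n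

  ∤2⇒≡1+q*2 : ∀ {n} → ¬ 2 ∣ n → ∃ λ q → n ≡ suc (q * 2)
  ∤2⇒≡1+q*2 {n} 2∤n with n % 2 | m%n<n n 2 | m≡m%n+[m/n]*n n 2
  ... | 0           | _                 | n≡2q   = contradiction (divides (n / 2) n≡2q) 2∤n
  ... | 1           | _                 | n≡1+2q = n / 2 , n≡1+2q
  ... | suc (suc _) | s≤s (s≤s ())      | _

  module _ (a : ℕ) where

    -- Peel off gcd(j, a) ≥ 2 repeatedly; each step at least halves j and costs one factor a.
    ∣coprime*^ : ∀ j → 0 < j → ∃₂ λ c k → Coprime c a × j ∣ c * a ^ k × 2 ^ k ≤ j
    ∣coprime*^ = <-rec _ step
      where
      step : ∀ j → (∀ {i} → i < j → 0 < i → ∃₂ λ c k → Coprime c a × i ∣ c * a ^ k × 2 ^ k ≤ i) →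
             0 < j → ∃₂ λ c k → Coprime c a × j ∣ c * a ^ k × 2 ^ k ≤ j
      step j rec 0<j with coprime? j a
      ... | yes j⊥a = j , 0 , j⊥a , m∣m*n 1 , 0<j
      ... | no ¬j⊥a with gcd[m,n]∣m j a
      ...   | divides i j≡i*g = extend (rec i<j 0<i)
        where
        g : ℕ
        g = gcd j a
        j≢0 : j ≢ 0
        j≢0 = n>0⇒n≢0 0<j
        2≤g : 2 ≤ g
        2≤g with g | gcd[m,n]≢0 j a (inj₁ j≢0) | (λ g≡1 → ¬j⊥a (gcd≡1⇒coprime g≡1))
        ... | 0           | g≢0 | _   = contradiction refl g≢0
        ... | 1           | _   | g≢1 = contradiction refl g≢1
        ... | suc (suc _) | _   | _   = s≤s (s≤s z≤n)
        0<i : 0 < i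
        0<i = n≢0⇒n>0 (λ i≡0 → j≢0 (trans j≡i*g (cong (_* g) i≡0)))
        i<j : i < j
        i<j = subst (i <_) (sym j≡i*g) (m<m*n i g {{>-nonZero 0<i}} 2≤g)
        regroup : ∀ c x a → c * x * a ≡ c * (a * x)
        regroup = solve-∀
        extend : (∃₂ λ c k → Coprime c a × i ∣ c * a ^ k × 2 ^ k ≤ i) →
                 ∃₂ λ c k → Coprime c a × j ∣ c * a ^ k × 2 ^ k ≤ j
        extend (c , k , c⊥a , i∣ca^k , 2^k≤i) = c , suc k , c⊥a , j∣ca^[1+k] , 2^[1+k]≤j
          where
          j∣ca^[1+k] : j ∣ c * a ^ suc k
          j∣ca^[1+k] = subst₂ _∣_ (sym j≡i*g) (regroup c (a ^ k) a) (*-pres-∣ i∣ca^k (gcd[m,n]∣n j a))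
          2^[1+k]≤j : 2 ^ suc k ≤ j
          2^[1+k]≤j = begin
            2 * 2 ^ k ≤⟨ *-monoʳ-≤ 2 2^k≤i ⟩
            2 * i     ≤⟨ *-monoˡ-≤ i 2≤g ⟩
            g * i     ≡⟨ *-comm g i ⟩
            i * g     ≡⟨ j≡i*g ⟨
            j         ∎
            where open ≤-Reasoning

    3+n<2^[2+n] : ∀ n → 3 + n < 2 ^ (2 + n)
    3+n<2^[2+n] zero    = ≤-refl
    3+n<2^[2+n] (suc n) = begin-strict
      4 + n                 <⟨ +-monoʳ-< 1 (3+n<2^[2+n] n) ⟩
      1 + 2 ^ (2 + n)       ≤⟨ +-monoˡ-≤ (2 ^ (2 + n)) (m^n>0 2 (2 + n)) ⟩
      2 ^ (2 + n) + 2 ^ (2 + n) ≡⟨ cong (2 ^ (2 + n) +_) (+-identityʳ _) ⟨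
      2 ^ (3 + n)           ∎
      where open ≤-Reasoning

    ∣coprime*^[n∸2] : ∀ {j} → 3 ≤ j → ∃ λ c → Coprime c a × j ∣ c * a ^ (j ∸ 2)
    ∣coprime*^[n∸2] {suc (suc (suc n))} (s≤s (s≤s (s≤s _))) with ∣coprime*^ (3 + n) z<s
    ... | c , k , c⊥a , ∣ca^k , 2^k≤3+n = c , c⊥a , ∣-trans ∣ca^k (divides (a ^ (1 + n ∸ k)) ca^k∣ca^[1+n])
      where
      k≤1+n : k ≤ 1 + n
      k≤1+n with k ≤? 1 + n
      ... | yes k≤1+n = k≤1+n
      ... | no k≰1+n  = contradiction (≤-trans (^-monoʳ-≤ 2 (≰⇒> k≰1+n)) 2^k≤3+n) (<⇒≱ (3+n<2^[2+n] n))
      ca^k∣ca^[1+n] : c * a ^ (1 + n) ≡ a ^ (1 + n ∸ k) * (c * a ^ k)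
      ca^k∣ca^[1+n] = begin
        c * a ^ (1 + n)                 ≡⟨ cong (λ e → c * a ^ e) (m+[n∸m]≡n k≤1+n) ⟨
        c * a ^ (k + (1 + n ∸ k))       ≡⟨ cong (c *_) (^-distribˡ-+-* a k (1 + n ∸ k)) ⟩
        c * (a ^ k * a ^ (1 + n ∸ k))   ≡⟨ regroup c (a ^ k) (a ^ (1 + n ∸ k)) ⟩
        a ^ (1 + n ∸ k) * (c * a ^ k)   ∎
        where
        open ≡-Reasoning
        regroup : ∀ x y z → x * (y * z) ≡ z * (x * y)
        regroup = solve-∀

    binomial*power-divisible : ∀ {n k} → 3 + k ≤ n →
      ∃₂ λ c r → Coprime c a × c * ((n C k) * a ^ (n ∸ k)) ≡ n * (a * a) * r
    binomial*power-divisible {suc n} {k} 3+k≤1+n = conclude (∣coprime*^[n∸2] 3≤j)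
      where
      B j : ℕ
      B = suc n C k
      j = suc n ∸ k
      k≤n : k ≤ n
      k≤n = ≤-trans (m≤n+m k 2) (≤-pred 3+k≤1+n)
      3≤j : 3 ≤ j
      3≤j = m+n≤o⇒m≤o∸n 3 3+k≤1+n
      2≤j : 2 ≤ j
      2≤j = ≤-trans (n≤1+n 2) 3≤j
      regroup₁ : ∀ c B a x → c * (B * (a * (a * x))) ≡ B * (a * a) * (c * x)
      regroup₁ = solve-∀
      regroup₂ : ∀ B A r j → B * A * (r * j) ≡ B * j * A * r
      regroup₂ = solve-∀
      regroup₃ : ∀ n B A r → n * B * A * r ≡ n * A * (B * r)
      regroup₃ = solve-∀
      conclude : (∃ λ c → Coprime c a × j ∣ c * a ^ (j ∸ 2)) →
                 ∃₂ λ c r → Coprime c a × c * (B * a ^ j) ≡ suc n * (a * a) * r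
      conclude (c , c⊥a , divides r c*a^[j∸2]≡r*j) = c , (n C k) * r , c⊥a , (begin
        c * (B * a ^ j)                   ≡⟨ cong (λ e → c * (B * a ^ e)) (m+[n∸m]≡n 2≤j) ⟨
        c * (B * (a * (a * a ^ (j ∸ 2)))) ≡⟨ regroup₁ c B a (a ^ (j ∸ 2)) ⟩
        B * (a * a) * (c * a ^ (j ∸ 2))   ≡⟨ cong (B * (a * a) *_) c*a^[j∸2]≡r*j ⟩
        B * (a * a) * (r * j)             ≡⟨ regroup₂ B (a * a) r j ⟩
        B * j * (a * a) * r               ≡⟨ cong (λ e → e * (a * a) * r) ([1+n]Ck*[1+n∸k]≡[1+n]*nCk k≤n) ⟩
        suc n * (n C k) * (a * a) * r     ≡⟨ regroup₃ (suc n) (n C k) (a * a) r ⟩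
        suc n * (a * a) * ((n C k) * r)   ∎)
        where open ≡-Reasoning

-- Integers inside ℚ

module _ where
  open import Data.Integer.Base using (+_; -[1+_])
  open import Relation.Binary.PropositionalEquality
  open import Data.Rational.Base using (mkℚ; _/_; 0ℚ; 1ℚ; _+_; _*_; _-_; -_)
  import Data.Nat.Coprimality as ℕ
  import Data.Integer.Properties as ℤ
  open import Data.Rational.Properties
  open ≡-Reasoning

  ι : ℤ → ℚ
  ι z = z / 1

  ι-mkℚ : ∀ z → ι z ≡ mkℚ z 0 (ℕ.sym (ℕ.1-coprimeTo ℤ.∣ z ∣))
  ι-mkℚ (+ n)    = normalize-coprime (ℕ.sym (ℕ.1-coprimeTo n))
  ι-mkℚ -[1+ n ] = cong -_ (normalize-coprime (ℕ.sym (ℕ.1-coprimeTo (suc n))))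

  ι-homo-+ : ∀ x y → ι (x ℤ.+ y) ≡ ι x + ι y
  ι-homo-+ x y rewrite ι-mkℚ x | ι-mkℚ y =
    cong (_/ 1) (cong₂ ℤ._+_ (sym (ℤ.*-identityʳ x)) (sym (ℤ.*-identityʳ y)))

  ι-homo-* : ∀ x y → ι (x ℤ.* y) ≡ ι x * ι y
  ι-homo-* x y rewrite ι-mkℚ x | ι-mkℚ y = refl

  ι-homo‿- : ∀ x → ι (ℤ.- x) ≡ - ι x
  ι-homo‿- x = begin
    ι (ℤ.- x)                     ≡⟨ +-identityˡ (ι (ℤ.- x)) ⟨
    0ℚ + ι (ℤ.- x)                ≡⟨ cong (_+ ι (ℤ.- x)) (+-inverseˡ (ι x)) ⟨
    (- ι x + ι x) + ι (ℤ.- x)     ≡⟨ +-assoc (- ι x) (ι x) (ι (ℤ.- x)) ⟩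
    - ι x + (ι x + ι (ℤ.- x))     ≡⟨ cong (λ z → - ι x + z) (ι-homo-+ x (ℤ.- x)) ⟨
    - ι x + ι (x ℤ.+ ℤ.- x)       ≡⟨ cong (λ z → - ι x + ι z) (ℤ.+-inverseʳ x) ⟩
    - ι x + 0ℚ                    ≡⟨ +-identityʳ (- ι x) ⟩
    - ι x                         ∎

  ι-homo-- : ∀ x y → ι (x ℤ.- y) ≡ ι x - ι y
  ι-homo-- x y = trans (ι-homo-+ x (ℤ.- y)) (cong (λ z → ι x + z) (ι-homo‿- y))

  ι-pos-* : ∀ m n → ι (+ (m ℕ.* n)) ≡ ι (+ m) * ι (+ n)
  ι-pos-* m n = trans (cong ι (ℤ.pos-* m n)) (ι-homo-* (+ m) (+ n))

  ι-injective : ∀ {x y} → ι x ≡ ι y → x ≡ y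
  ι-injective {x} {y} ιx≡ιy rewrite ι-mkℚ x | ι-mkℚ y = cong ℚ.↥_ ιx≡ιy

  ι-nonZero : ∀ n .{{_ : ℕ.NonZero n}} → ℚ.NonZero (ι (+ n))
  ι-nonZero (suc n) = subst ℚ.NonZero (sym (ι-mkℚ (+ suc n))) _

  *-cancelʳ-≡ : ∀ {x y} p .{{_ : ℚ.NonZero p}} → x * p ≡ y * p → x ≡ y
  *-cancelʳ-≡ {x} {y} p xp≡yp = begin
    x                ≡⟨ *-identityʳ x ⟨
    x * 1ℚ           ≡⟨ cong (x *_) (*-inverseʳ p) ⟨
    x * (p * ℚ.1/ p) ≡⟨ *-assoc x p (ℚ.1/ p) ⟨
    x * p * ℚ.1/ p   ≡⟨ cong (_* ℚ.1/ p) xp≡yp ⟩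
    y * p * ℚ.1/ p   ≡⟨ *-assoc y p (ℚ.1/ p) ⟩
    y * (p * ℚ.1/ p) ≡⟨ cong (y *_) (*-inverseʳ p) ⟩
    y * 1ℚ           ≡⟨ *-identityʳ y ⟩
    y                ∎

  1/[1+n]*[1+n]≡1 : ∀ n → (+ 1) / suc n * ι (+ suc n) ≡ 1ℚ
  1/[1+n]*[1+n]≡1 n = trans
    (cong₂ _*_ (normalize-coprime (ℕ.1-coprimeTo (suc n))) (ι-mkℚ (+ suc n)))
    (*-inverseˡ (mkℚ (+ suc n) 0 (ℕ.sym (ℕ.1-coprimeTo (suc n)))))

module _ where
  open import Data.Integer.Base using (+_)
  open import Data.Product using (_×_)
  open import Relation.Binary.PropositionalEquality
  open import Data.Rational.Base using (0ℚ; _+_; _*_; _-_)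
  import Data.Integer.Properties as ℤ
  open import Data.Integer.Divisibility using (_∣_)
  import Data.Integer.Divisibility.Signed as Signed
  open import Data.Integer.Coprimality using (coprime-divisor)
  open import Data.Nat.Coprimality as ℕ using (Coprime)
  open import Data.Rational.Properties
  open import Tactic.RingSolver using (solve-∀)
  open import Tactic.RingSolver.Core.AlmostCommutativeRing using (AlmostCommutativeRing; fromCommutativeRing)
  open import Relation.Nullary.Decidable using (dec⇒maybe)

  ℚ-ring : AlmostCommutativeRing _ _
  ℚ-ring = fromCommutativeRing +-*-commutativeRing (λ x → dec⇒maybe (0ℚ ≟ x))

  IsInt : ℚ → Set
  IsInt x = ∃ λ z → x ≡ ι z

  IsInt-+ : ∀ {x y} → IsInt x → IsInt y → IsInt (x + y)
  IsInt-+ (z , refl) (w , refl) = z ℤ.+ w , sym (ι-homo-+ z w)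

  IsInt-* : ∀ {x y} → IsInt x → IsInt y → IsInt (x * y)
  IsInt-* (z , refl) (w , refl) = z ℤ.* w , sym (ι-homo-* z w)

  IsInt-- : ∀ {x y} → IsInt x → IsInt y → IsInt (x - y)
  IsInt-- (z , refl) (w , refl) = z ℤ.- w , trans (cong (λ u → ι z + u) (sym (ι-homo‿- w))) (sym (ι-homo-+ z (ℤ.- w)))

  -- d ∣[ a ] x says x ∈ d ℤ₍ₐ₎.
  _∣[_]_ : ℕ → ℕ → ℚ → Set
  d ∣[ a ] x = ∃₂ λ c q → Coprime c a × ι (+ c) * x ≡ ι (+ d) * ι q

  ∣[]-0 : ∀ {d a} → d ∣[ a ] 0ℚ
  ∣[]-0 {d} {a} = 1 , + 0 , ℕ.1-coprimeTo a , trans (*-zeroʳ (ι (+ 1))) (sym (*-zeroʳ (ι (+ d))))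

  ∣[]-+ : ∀ {d a x y} → d ∣[ a ] x → d ∣[ a ] y → d ∣[ a ] (x + y)
  ∣[]-+ {d} {a} {x} {y} (c₁ , q₁ , c₁⊥a , c₁x≡dq₁) (c₂ , q₂ , c₂⊥a , c₂y≡dq₂) =
    c₁ ℕ.* c₂ , + c₂ ℤ.* q₁ ℤ.+ + c₁ ℤ.* q₂ , coprime-* c₁⊥a c₂⊥a , (begin
      ι (+ (c₁ ℕ.* c₂)) * (x + y)
        ≡⟨ cong (_* (x + y)) (ι-pos-* c₁ c₂) ⟩
      ι (+ c₁) * ι (+ c₂) * (x + y)
        ≡⟨ distribute (ι (+ c₁)) (ι (+ c₂)) x y ⟩
      ι (+ c₂) * (ι (+ c₁) * x) + ι (+ c₁) * (ι (+ c₂) * y)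
        ≡⟨ cong₂ (λ u v → ι (+ c₂) * u + ι (+ c₁) * v) c₁x≡dq₁ c₂y≡dq₂ ⟩
      ι (+ c₂) * (D * ι q₁) + ι (+ c₁) * (D * ι q₂)
        ≡⟨ collect D (ι (+ c₁)) (ι (+ c₂)) (ι q₁) (ι q₂) ⟩
      D * (ι (+ c₂) * ι q₁ + ι (+ c₁) * ι q₂)
        ≡⟨ cong (D *_) (cong₂ _+_ (ι-homo-* (+ c₂) q₁) (ι-homo-* (+ c₁) q₂)) ⟨
      D * (ι (+ c₂ ℤ.* q₁) + ι (+ c₁ ℤ.* q₂))
        ≡⟨ cong (D *_) (ι-homo-+ (+ c₂ ℤ.* q₁) (+ c₁ ℤ.* q₂)) ⟨
      D * ι (+ c₂ ℤ.* q₁ ℤ.+ + c₁ ℤ.* q₂)                 ∎)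
    where
    open ≡-Reasoning
    D : ℚ
    D = ι (+ d)
    distribute : ∀ c₁ c₂ x y → c₁ * c₂ * (x + y) ≡ c₂ * (c₁ * x) + c₁ * (c₂ * y)
    distribute = solve-∀ ℚ-ring
    collect : ∀ D c₁ c₂ q₁ q₂ → c₂ * (D * q₁) + c₁ * (D * q₂) ≡ D * (c₂ * q₁ + c₁ * q₂)
    collect = solve-∀ ℚ-ring

  ∣[]-intro : ∀ {d a c N r x} → Coprime c a → c ℕ.* N ≡ d ℕ.* r → IsInt x → d ∣[ a ] (ι (+ N) * x)
  ∣[]-intro {d} {a} {c} {N} {r} c⊥a cN≡dr (z , refl) = c , + r ℤ.* z , c⊥a , (begin
    ι (+ c) * (ι (+ N) * ι z)
      ≡⟨ *-assoc (ι (+ c)) (ι (+ N)) (ι z) ⟨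
    ι (+ c) * ι (+ N) * ι z
      ≡⟨ cong (_* ι z) (ι-pos-* c N) ⟨
    ι (+ (c ℕ.* N)) * ι z
      ≡⟨ cong (λ u → ι (+ u) * ι z) cN≡dr ⟩
    ι (+ (d ℕ.* r)) * ι z
      ≡⟨ cong (_* ι z) (ι-pos-* d r) ⟩
    ι (+ d) * ι (+ r) * ι z
      ≡⟨ *-assoc (ι (+ d)) (ι (+ r)) (ι z) ⟩
    ι (+ d) * (ι (+ r) * ι z)
      ≡⟨ cong (ι (+ d) *_) (ι-homo-* (+ r) z) ⟨
    ι (+ d) * ι (+ r ℤ.* z)       ∎)
    where open ≡-Reasoning

  ∣[]⇒∣ : ∀ {a z} → a ∣[ a ] ι z → + a ∣ z
  ∣[]⇒∣ {a} {z} (c , q , c⊥a , cz≡aq) =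
    coprime-divisor (+ a) (+ c) z (ℕ.sym c⊥a)
      (Signed.∣⇒∣ᵤ {+ a} {+ c ℤ.* z} (Signed.divides q (ι-injective (begin
        ι (+ c ℤ.* z)     ≡⟨ ι-homo-* (+ c) z ⟩
        ι (+ c) * ι z     ≡⟨ cz≡aq ⟩
        ι (+ a) * ι q     ≡⟨ *-comm (ι (+ a)) (ι q) ⟩
        ι q * ι (+ a)     ≡⟨ ι-homo-* q (+ a) ⟨
        ι (q ℤ.* + a)     ∎))))
    where open ≡-Reasoning

  IsInt-cancel-coprime : ∀ {a c x} .{{_ : ℕ.NonZero a}} → Coprime c a →
                         IsInt (ι (+ c) * x) → IsInt (ι (+ a) * x) → IsInt x
  IsInt-cancel-coprime {a} {c} {x} c⊥a (v , cx≡v) (u , ax≡u) = quotient a∣u ,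
    *-cancelʳ-≡ (ι (+ a)) {{ι-nonZero a}} (begin
      x * ι (+ a)                  ≡⟨ *-comm x (ι (+ a)) ⟩
      ι (+ a) * x                  ≡⟨ ax≡u ⟩
      ι u                          ≡⟨ cong ι (equality a∣u) ⟩
      ι (quotient a∣u ℤ.* + a)     ≡⟨ ι-homo-* (quotient a∣u) (+ a) ⟩
      ι (quotient a∣u) * ι (+ a)   ∎)
    where
    open ≡-Reasoning
    open Signed._∣_
    a∣u : + a Signed.∣ u
    a∣u = Signed.∣ᵤ⇒∣ (∣[]⇒∣ {a} {u} (c , v , c⊥a , (begin
      ι (+ c) * ι u           ≡⟨ cong (ι (+ c) *_) ax≡u ⟨
      ι (+ c) * (ι (+ a) * x) ≡⟨ x∙yz≈y∙xz (ι (+ c)) (ι (+ a)) x ⟩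
      ι (+ a) * (ι (+ c) * x) ≡⟨ cong (ι (+ a) *_) cx≡v ⟩
      ι (+ a) * ι v           ∎)))
      where
      x∙yz≈y∙xz : ∀ x y z → x * (y * z) ≡ y * (x * z)
      x∙yz≈y∙xz = solve-∀ ℚ-ring

  IsInt-from-local : ∀ {a x y} .{{_ : ℕ.NonZero a}} → a ∣[ a ] (x - y) → IsInt y → IsInt (ι (+ a) * x) → IsInt x
  IsInt-from-local {a} {x} {y} (c , q , c⊥a , c[x-y]≡aq) (z , refl) ax∈ℤ =
    IsInt-cancel-coprime c⊥a
      (subst IsInt cx≡ (IsInt-+ (+ a ℤ.* q , sym (ι-homo-* (+ a) q)) (+ c ℤ.* z , sym (ι-homo-* (+ c) z)))) ax∈ℤ
    where
    open ≡-Reasoning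
    cx≡ : ι (+ a) * ι q + ι (+ c) * ι z ≡ ι (+ c) * x
    cx≡ = begin
      ι (+ a) * ι q + ι (+ c) * ι z           ≡⟨ cong (_+ ι (+ c) * ι z) c[x-y]≡aq ⟨
      ι (+ c) * (x - ι z) + ι (+ c) * ι z     ≡⟨ cancel (ι (+ c)) x (ι z) ⟩
      ι (+ c) * x                             ∎
      where
      cancel : ∀ c x y → c * (x - y) + c * y ≡ c * x
      cancel = solve-∀ ℚ-ring

-- Congruences modulo an even number

module _ where
  open import Data.Integer.Base using (+_)
  open import Relation.Binary.PropositionalEquality
  import Data.Nat.Properties as ℕ
  open import Data.Nat.Combinatorics using (_C_)
  import Data.Integer.Properties as ℤ
  open import Data.Integer.Divisibility using (_∣_)
  import Data.Integer.Divisibility.Signed as Signed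
  open import Data.Integer.Tactic.RingSolver using (solve-∀)
  open ≡-Reasoning

  -- y ≡ 1 − (n + 2) h gives (n + 3) h y ≡ (n + 3) h, because (n + 3)(n + 2) h² is a multiple of 2h.
  ∣-drop-factor : ∀ {a} h n x y → a ≡ h ℕ.* 2 →
                  + a ∣ x ℤ.- + 1 ℤ.+ + ((3 ℕ.+ n) ℕ.* h) ℤ.* y →
                  + a ∣ y ℤ.- + 1 ℤ.+ + ((2 ℕ.+ n) ℕ.* h) →
                  + a ∣ x ℤ.- + 1 ℤ.+ + ((3 ℕ.+ n) ℕ.* h)
  ∣-drop-factor h n x y refl a∣X a∣Y = Signed.∣⇒∣ᵤ {A} {x ℤ.- + 1 ℤ.+ + (suc (suc (suc n)) ℕ.* h)}
    (subst (Signed._∣_ A) (sym (trans (cong (λ z → x ℤ.- + 1 ℤ.+ z) (ℤ.pos-* (3 ℕ.+ n) h)) (identity x y P Q H)))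
      (Signed.∣m∣n⇒∣m+n (Signed.∣m∣n⇒∣m-n a∣X′ (Signed.∣n⇒∣m*n (P ℤ.* H) a∣Y′)) a∣PQHH))
    where
    A H P Q : ℤ
    A = + (h ℕ.* 2)
    H = + h
    P = + (3 ℕ.+ n)
    Q = + (2 ℕ.+ n)
    T : ℕ
    T = (3 ℕ.+ n) C (1 ℕ.+ n)
    identity : ∀ x y P Q H → x ℤ.- + 1 ℤ.+ P ℤ.* H ≡
      (x ℤ.- + 1 ℤ.+ P ℤ.* H ℤ.* y) ℤ.- P ℤ.* H ℤ.* (y ℤ.- + 1 ℤ.+ Q ℤ.* H) ℤ.+ P ℤ.* Q ℤ.* (H ℤ.* H)
    identity = solve-∀
    a∣X′ : A Signed.∣ x ℤ.- + 1 ℤ.+ P ℤ.* H ℤ.* y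
    a∣X′ = subst (λ z → A Signed.∣ x ℤ.- + 1 ℤ.+ z ℤ.* y) (ℤ.pos-* (3 ℕ.+ n) h)
             (Signed.∣ᵤ⇒∣ {A} {x ℤ.- + 1 ℤ.+ + ((3 ℕ.+ n) ℕ.* h) ℤ.* y} a∣X)
    a∣Y′ : A Signed.∣ y ℤ.- + 1 ℤ.+ Q ℤ.* H
    a∣Y′ = subst (λ z → A Signed.∣ y ℤ.- + 1 ℤ.+ z) (ℤ.pos-* (2 ℕ.+ n) h)
             (Signed.∣ᵤ⇒∣ {A} {y ℤ.- + 1 ℤ.+ + ((2 ℕ.+ n) ℕ.* h)} a∣Y)
    a∣PQHH : A Signed.∣ P ℤ.* Q ℤ.* (H ℤ.* H)
    a∣PQHH = Signed.divides (+ T ℤ.* H) (begin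
      P ℤ.* Q ℤ.* (H ℤ.* H)           ≡⟨ cong (ℤ._* (H ℤ.* H)) (ℤ.pos-* (3 ℕ.+ n) (2 ℕ.+ n)) ⟨
      + ((3 ℕ.+ n) ℕ.* (2 ℕ.+ n)) ℤ.* (H ℤ.* H) ≡⟨ cong (λ z → + z ℤ.* (H ℤ.* H)) ([2+n]Cn*2≡[2+n]*[1+n] (suc n)) ⟨
      + (T ℕ.* 2) ℤ.* (H ℤ.* H)       ≡⟨ cong (ℤ._* (H ℤ.* H)) (ℤ.pos-* T 2) ⟩
      + T ℤ.* + 2 ℤ.* (H ℤ.* H)       ≡⟨ regroup (+ T) H ⟩
      + T ℤ.* H ℤ.* (H ℤ.* + 2)       ≡⟨ cong (+ T ℤ.* H ℤ.*_) (ℤ.pos-* h 2) ⟨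
      + T ℤ.* H ℤ.* A                 ∎)
      where
      regroup : ∀ T H → T ℤ.* + 2 ℤ.* (H ℤ.* H) ≡ T ℤ.* H ℤ.* (H ℤ.* + 2)
      regroup = solve-∀

  ∣-even-multiple : ∀ {a} h {n} q z → a ≡ h ℕ.* 2 → n ≡ q ℕ.* 2 →
    + a ∣ z ℤ.- + 1 ℤ.+ + (n ℕ.* h) → + a ∣ z ℤ.- + 1
  ∣-even-multiple h {n} q z refl n≡2q a∣ = Signed.∣⇒∣ᵤ {A} {z ℤ.- + 1}
    (subst (Signed._∣_ A) (drop (z ℤ.- + 1) (+ (n ℕ.* h)))
      (Signed.∣m∣n⇒∣m-n (Signed.∣ᵤ⇒∣ {A} {z ℤ.- + 1 ℤ.+ + (n ℕ.* h)} a∣) a∣nh))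
    where
    A : ℤ
    A = + (h ℕ.* 2)
    drop : ∀ x y → x ℤ.+ y ℤ.- y ≡ x
    drop = solve-∀
    a∣nh : A Signed.∣ + (n ℕ.* h)
    a∣nh = Signed.divides (+ q) (begin
      + (n ℕ.* h)             ≡⟨ cong (λ k → + (k ℕ.* h)) n≡2q ⟩
      + (q ℕ.* 2 ℕ.* h)       ≡⟨ cong +_ (ℕ.*-assoc q 2 h) ⟩
      + (q ℕ.* (2 ℕ.* h))     ≡⟨ cong (λ k → + (q ℕ.* k)) (ℕ.*-comm 2 h) ⟩
      + (q ℕ.* (h ℕ.* 2))     ≡⟨ ℤ.pos-* q (h ℕ.* 2) ⟩
      + q ℤ.* A               ∎)

  ∣-odd-multiple : ∀ {a} h {n} q z → a ≡ h ℕ.* 2 → n ≡ suc (q ℕ.* 2) →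
    + a ∣ z ℤ.- + 1 ℤ.+ + (n ℕ.* h) → + a ∣ z ℤ.- (+ 1 ℤ.+ + h)
  ∣-odd-multiple h {n} q z refl n≡1+2q a∣ = Signed.∣⇒∣ᵤ {A} {z ℤ.- (+ 1 ℤ.+ + h)}
    (subst (Signed._∣_ A) shift
      (Signed.∣m∣n⇒∣m-n (Signed.∣ᵤ⇒∣ {A} {z ℤ.- + 1 ℤ.+ + (n ℕ.* h)} a∣) (Signed.∣n⇒∣m*n (+ suc q) (Signed.∣-refl {A}))))
    where
    A : ℤ
    A = + (h ℕ.* 2)
    A≡h*2 : A ≡ + h ℤ.* + 2
    A≡h*2 = ℤ.pos-* h 2
    nh≡h+qA : + (n ℕ.* h) ≡ + h ℤ.+ + q ℤ.* A
    nh≡h+qA = begin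
      + (n ℕ.* h)                      ≡⟨ cong (λ k → + (k ℕ.* h)) n≡1+2q ⟩
      + (h ℕ.+ q ℕ.* 2 ℕ.* h)          ≡⟨ cong (λ k → + (h ℕ.+ k)) (trans (ℕ.*-assoc q 2 h) (cong (q ℕ.*_) (ℕ.*-comm 2 h))) ⟩
      + (h ℕ.+ q ℕ.* (h ℕ.* 2))        ≡⟨ cong (λ k → + h ℤ.+ k) (ℤ.pos-* q (h ℕ.* 2)) ⟩
      + h ℤ.+ + q ℤ.* A                ∎
    regroup : ∀ z h q → z ℤ.- + 1 ℤ.+ (h ℤ.+ q ℤ.* (h ℤ.* + 2)) ℤ.- (+ 1 ℤ.+ q) ℤ.* (h ℤ.* + 2) ≡ z ℤ.- (+ 1 ℤ.+ h)
    regroup = solve-∀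
    shift : z ℤ.- + 1 ℤ.+ + (n ℕ.* h) ℤ.- + suc q ℤ.* A ≡ z ℤ.- (+ 1 ℤ.+ + h)
    shift = begin
      z ℤ.- + 1 ℤ.+ + (n ℕ.* h) ℤ.- + suc q ℤ.* A
        ≡⟨ cong (λ k → z ℤ.- + 1 ℤ.+ k ℤ.- + suc q ℤ.* A) nh≡h+qA ⟩
      z ℤ.- + 1 ℤ.+ (+ h ℤ.+ + q ℤ.* A) ℤ.- (+ 1 ℤ.+ + q) ℤ.* A
        ≡⟨ cong (λ B → z ℤ.- + 1 ℤ.+ (+ h ℤ.+ + q ℤ.* B) ℤ.- (+ 1 ℤ.+ + q) ℤ.* B) A≡h*2 ⟩
      z ℤ.- + 1 ℤ.+ (+ h ℤ.+ + q ℤ.* (+ h ℤ.* + 2)) ℤ.- (+ 1 ℤ.+ + q) ℤ.* (+ h ℤ.* + 2)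
        ≡⟨ regroup z (+ h) (+ q) ⟩
      z ℤ.- (+ 1 ℤ.+ + h)                                        ∎

module _ where
  open import Data.Fin.Base as Fin using (Fin; toℕ; fromℕ; inject₁)
  open import Data.Fin.Properties using (toℕ-fromℕ; toℕ-inject₁)
  open import Data.Fin.Relation.Unary.Top using (view; ‵fromℕ; ‵inject₁)
  open import Data.Vec.Base using (Vec; []; _∷_; _∷ʳ_; lookup)
  open import Relation.Binary.PropositionalEquality

  lookup-∷ʳ-fromℕ : ∀ {A : Set} {n} (xs : Vec A n) x → lookup (xs ∷ʳ x) (fromℕ n) ≡ x
  lookup-∷ʳ-fromℕ []       x = refl
  lookup-∷ʳ-fromℕ (_ ∷ xs) x = lookup-∷ʳ-fromℕ xs x

  lookup-∷ʳ-inject₁ : ∀ {A : Set} {n} (xs : Vec A n) x i → lookup (xs ∷ʳ x) (inject₁ i) ≡ lookup xs i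
  lookup-∷ʳ-inject₁ (_ ∷ xs) x Fin.zero    = refl
  lookup-∷ʳ-inject₁ (_ ∷ xs) x (Fin.suc i) = lookup-∷ʳ-inject₁ xs x i

  lookup-∷ʳ : ∀ {A : Set} {n} {f : ℕ → A} (xs : Vec A n) x k →
              (∀ j → lookup xs j ≡ f (toℕ j)) → x ≡ f n → lookup (xs ∷ʳ x) k ≡ f (toℕ k)
  lookup-∷ʳ {n = n} {f} xs x k xs≗f x≡fn with view k
  ... | ‵fromℕ     = trans (lookup-∷ʳ-fromℕ xs x) (trans x≡fn (cong f (sym (toℕ-fromℕ n))))
  ... | ‵inject₁ j = trans (lookup-∷ʳ-inject₁ xs x j) (trans (xs≗f j) (cong f (sym (toℕ-inject₁ j))))

-- The generalized Genocchi numbers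

module _ where
  open import Level using (0ℓ)
  open import Data.Integer.Base using (+_)
  open import Data.Product using (_×_)
  open import Relation.Binary.PropositionalEquality
  open import Data.Rational.Base using (0ℚ; 1ℚ; _+_; _*_; _-_; -_; _/_)
  open import Data.Nat.Combinatorics using (nCn≡1; nC1≡n)
  open import Algebra.Bundles using (CommutativeRing)
  import Data.Rational.Properties as ℚ
  import Data.Nat.Properties as ℕ
  import Data.Integer.Properties as ℤ
  open import Data.Fin.Base using (Fin; toℕ)
  open import Data.Vec.Base using (_∷ʳ_; lookup)
  import Data.List.Base as List
  import Data.List.Properties as List
  open import Tactic.RingSolver using (solve-∀)
  open import Data.Nat.Induction using (<-rec)
  import Data.Nat.Divisibility as ℕ
  open import Data.Integer.Divisibility using (_∣_)
  open import Relation.Nullary using (¬_)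
  import Data.Nat.Coprimality as ℕ
  open import Algebra.Properties.Group ℚ.+-0-group using () renaming (∙-cancelʳ to +-cancelʳ)

  ℚ-commutativeSemiring : CommutativeSemiring 0ℓ 0ℓ
  ℚ-commutativeSemiring = CommutativeRing.commutativeSemiring ℚ.+-*-commutativeRing
  open FiniteSums ℚ-commutativeSemiring
  open BinomialConvolution ℚ-commutativeSemiring
  open import Algebra.Properties.Semiring.Mult (CommutativeRing.semiring ℚ.+-*-commutativeRing) using () renaming (_×_ to _×ₙ_)
  module ℕΣ = FiniteSums ℕ.+-*-commutativeSemiring
  open ≡-Reasoning

  ×ₙ≡ι* : ∀ n x → n ×ₙ x ≡ ι (+ n) * x
  ×ₙ≡ι* zero    x = sym (ℚ.*-zeroˡ x)
  ×ₙ≡ι* (suc n) x = begin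
    x + n ×ₙ x              ≡⟨ cong (λ u → x + u) (×ₙ≡ι* n x) ⟩
    x + ι (+ n) * x         ≡⟨ regroup (ι (+ n)) x ⟩
    (1ℚ + ι (+ n)) * x      ≡⟨ cong (_* x) (ι-homo-+ (+ 1) (+ n)) ⟨
    ι (+ suc n) * x         ∎
    where
    regroup : ∀ n x → x + n * x ≡ (1ℚ + n) * x
    regroup = solve-∀ ℚ-ring

  ι-Σ< : ∀ n f → ι (+ ℕΣ.Σ< n f) ≡ Σ< n (λ k → ι (+ f k))
  ι-Σ< zero    f = trans (cong (ι ∘ +_) (ℕΣ.Σ<-empty f)) (sym (Σ<-empty _))
  ι-Σ< (suc n) f = begin
    ι (+ ℕΣ.Σ< (suc n) f)                        ≡⟨ cong (ι ∘ +_) (ℕΣ.Σ<-suc n f) ⟩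
    ι (+ (f 0 ℕ.+ ℕΣ.Σ< n (f ∘ suc)))            ≡⟨ ι-homo-+ (+ f 0) (+ ℕΣ.Σ< n (f ∘ suc)) ⟩
    ι (+ f 0) + ι (+ ℕΣ.Σ< n (f ∘ suc))          ≡⟨ cong (λ u → ι (+ f 0) + u) (ι-Σ< n (f ∘ suc)) ⟩
    ι (+ f 0) + Σ< n (λ k → ι (+ f (suc k)))     ≡⟨ Σ<-suc n (λ k → ι (+ f k)) ⟨
    Σ< (suc n) (λ k → ι (+ f k))                 ∎

  data Parity (a : ℕ) : Set where
    odd  : ℕ.Coprime 2 a → Parity a
    even : ∀ h → a ≡ h ℕ.* 2 → Parity a

  -- An integer representing a/2 modulo a ℤ₍ₐ₎ (for odd a, a/2 ∈ a ℤ₍ₐ₎).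
  half : ∀ {a} → Parity a → ℕ
  half (odd _)    = 0
  half (even h _) = h

  module Genocchi (b : ℕ) where

    a : ℕ
    a = suc b

    Gₐ : ℕ → ℚ
    Gₐ n = G n a

    genVec-suc : ∀ n → genVec a (suc n) ≡ genVec a n ∷ʳ Gₐ n
    genVec-suc n = cong (genVec a n ∷ʳ_) (sym (lookup-∷ʳ-fromℕ (genVec a n) _))

    lookup-genVec : ∀ n (k : Fin n) → lookup (genVec a n) k ≡ Gₐ (toℕ k)
    lookup-genVec (suc n) k =
      trans (cong (λ v → lookup v k) (genVec-suc n)) (lookup-∷ʳ {f = Gₐ} (genVec a n) (Gₐ n) k (lookup-genVec n) refl)

    s : ℕ → ℚ
    s m = ι (+ powSum a m)

    G-unfold : ∀ n → Gₐ n ≡ δ₁ n - Σ< n (λ k → ι (+ (n C k)) * Gₐ k * s (n ∸ k)) * ((+ 1) / a)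
    G-unfold n = trans (lookup-∷ʳ-fromℕ (genVec a n) _) (cong (λ x → δ₁ n - x * ((+ 1) / a)) (begin
      List.foldr _+_ 0ℚ (List.map term (List.allFin n))
        ≡⟨ cong (List.foldr _+_ 0ℚ) (List.map-tabulate (λ i → i) term) ⟩
      List.foldr _+_ 0ℚ (List.tabulate term)
        ≡⟨ foldr-tabulate n term _ (λ i → cong (λ x → ι (+ (n C toℕ i)) * x * s (n ∸ toℕ i)) (lookup-genVec n i)) ⟩
      Σ< n (λ k → ι (+ (n C k)) * Gₐ k * s (n ∸ k))      ∎))
      where
      term : Fin n → ℚ
      term i = ι (+ (n C toℕ i)) * lookup (genVec a n) i * s (n ∸ toℕ i)

    powSum-zero : powSum a 0 ≡ a
    powSum-zero = trans (powSum≡Σ< a 0) (count a)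
      where
      count : ∀ n → ℕΣ.Σ< n (λ _ → 1) ≡ n
      count zero    = ℕΣ.Σ<-empty _
      count (suc n) = trans (ℕΣ.Σ<-suc n _) (cong suc (count n))

    G-recurrence′ : ∀ n → Σ< n (λ k → (n C k) ×ₙ Gₐ k * s (n ∸ k)) + Gₐ n * ι (+ a) ≡ ι (+ a) * δ₁ n
    G-recurrence′ n = begin
      Σ< n (λ k → (n C k) ×ₙ Gₐ k * s (n ∸ k)) + Gₐ n * ι (+ a)
        ≡⟨ cong (_+ Gₐ n * ι (+ a)) (Σ<-cong n (λ {k} _ → cong (_* s (n ∸ k)) (×ₙ≡ι* (n C k) (Gₐ k)))) ⟩
      A + Gₐ n * ι (+ a)                            ≡⟨ cong (λ x → A + x * ι (+ a)) (G-unfold n) ⟩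
      A + (δ₁ n - A * r) * ι (+ a)                  ≡⟨ regroup A (δ₁ n) r (ι (+ a)) ⟩
      ι (+ a) * δ₁ n + A * (1ℚ - r * ι (+ a))       ≡⟨ cong (λ x → ι (+ a) * δ₁ n + A * (1ℚ - x)) (1/[1+n]*[1+n]≡1 b) ⟩
      ι (+ a) * δ₁ n + A * (1ℚ - 1ℚ)                ≡⟨ cancel (ι (+ a) * δ₁ n) A ⟩
      ι (+ a) * δ₁ n                                ∎
      where
      A r : ℚ
      A = Σ< n (λ k → ι (+ (n C k)) * Gₐ k * s (n ∸ k))
      r = (+ 1) / a
      regroup : ∀ A d r a → A + (d - A * r) * a ≡ a * d + A * (1ℚ - r * a)
      regroup = solve-∀ ℚ-ring
      cancel : ∀ x A → x + A * (1ℚ - 1ℚ) ≡ x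
      cancel = solve-∀ ℚ-ring

    G-recurrence : ∀ n → (Gₐ ⋆ s) n ≡ ι (+ a) * δ₁ n
    G-recurrence n = begin
      (Gₐ ⋆ s) n                                    ≡⟨ Σ<-last n (λ k → (n C k) ×ₙ Gₐ k * s (n ∸ k)) ⟩
      Σ< n (λ k → (n C k) ×ₙ Gₐ k * s (n ∸ k)) + (n C n) ×ₙ Gₐ n * s (n ∸ n)
        ≡⟨ cong (λ x → Σ< n (λ k → (n C k) ×ₙ Gₐ k * s (n ∸ k)) + x) last-term ⟩
      Σ< n (λ k → (n C k) ×ₙ Gₐ k * s (n ∸ k)) + Gₐ n * ι (+ a)
        ≡⟨ G-recurrence′ n ⟩
      ι (+ a) * δ₁ n                                ∎
      where
      last-term : (n C n) ×ₙ Gₐ n * s (n ∸ n) ≡ Gₐ n * ι (+ a)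
      last-term = begin
        (n C n) ×ₙ Gₐ n * s (n ∸ n)  ≡⟨ cong₂ (λ c m → c ×ₙ Gₐ n * s m) (nCn≡1 n) (ℕ.n∸n≡0 n) ⟩
        1 ×ₙ Gₐ n * s 0              ≡⟨ cong₂ _*_ (ℚ.+-identityʳ (Gₐ n)) (cong (ι ∘ +_) powSum-zero) ⟩
        Gₐ n * ι (+ a)               ∎

    𝟙 : ℕ → ℚ
    𝟙 _ = 1ℚ

    aᵏ : ℕ → ℚ
    aᵏ k = ι (+ a ℕ.^ k)

    s⋆𝟙+δ₀≡s+aᵏ : ∀ m → (s ⋆ 𝟙) m + δ₀ m ≡ s m + aᵏ m
    s⋆𝟙+δ₀≡s+aᵏ m = begin
      (s ⋆ 𝟙) m + δ₀ m
        ≡⟨ cong₂ _+_ (Σ<-cong (suc m) (λ {k} _ → term k)) (δ₀≡0^ m) ⟩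
      Σ< (suc m) (λ k → ι (+ ((m C k) ℕ.* powSum a k))) + ι (+ 0 ℕ.^ m)
        ≡⟨ cong (_+ ι (+ 0 ℕ.^ m)) (ι-Σ< (suc m) (λ k → (m C k) ℕ.* powSum a k)) ⟨
      ι (+ ℕΣ.Σ< (suc m) (λ k → (m C k) ℕ.* powSum a k)) + ι (+ 0 ℕ.^ m)
        ≡⟨ ι-homo-+ (+ ℕΣ.Σ< (suc m) (λ k → (m C k) ℕ.* powSum a k)) (+ (0 ℕ.^ m)) ⟨
      ι (+ (ℕΣ.Σ< (suc m) (λ k → (m C k) ℕ.* powSum a k) ℕ.+ 0 ℕ.^ m))
        ≡⟨ cong (ι ∘ +_) (Σ[mCk*powSum[k]]+0^m≡powSum[m]+a^m a m) ⟩
      ι (+ (powSum a m ℕ.+ a ℕ.^ m))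
        ≡⟨ ι-homo-+ (+ powSum a m) (+ (a ℕ.^ m)) ⟩
      s m + aᵏ m ∎
      where
      term : ∀ k → (m C k) ×ₙ s k * 1ℚ ≡ ι (+ ((m C k) ℕ.* powSum a k))
      term k = begin
        (m C k) ×ₙ s k * 1ℚ         ≡⟨ ℚ.*-identityʳ _ ⟩
        (m C k) ×ₙ s k              ≡⟨ ×ₙ≡ι* (m C k) (s k) ⟩
        ι (+ (m C k)) * s k         ≡⟨ ι-pos-* (m C k) (powSum a k) ⟨
        ι (+ ((m C k) ℕ.* powSum a k)) ∎
      δ₀≡0^ : ∀ m → δ₀ m ≡ ι (+ 0 ℕ.^ m)
      δ₀≡0^ zero    = refl
      δ₀≡0^ (suc m) = refl

    aδ₁⋆𝟙 : ∀ n → ((λ k → ι (+ a) * δ₁ k) ⋆ 𝟙) n ≡ ι (+ a) * ι (+ n)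
    aδ₁⋆𝟙 zero    = begin
      Σ< 1 t                 ≡⟨ Σ<-suc 0 t ⟩
      t 0 + Σ< 0 (t ∘ suc)   ≡⟨ cong₂ _+_ (t≡ 0) (Σ<-empty (t ∘ suc)) ⟩
      ι (+ 1) * (ι (+ a) * 0ℚ) * 1ℚ + 0ℚ ≡⟨ vanish (ι (+ 1)) (ι (+ a)) ⟩
      ι (+ a) * 0ℚ           ∎
      where
      t : ℕ → ℚ
      t k = (0 C k) ×ₙ (ι (+ a) * δ₁ k) * 1ℚ
      t≡ : ∀ k → t k ≡ ι (+ (0 C k)) * (ι (+ a) * δ₁ k) * 1ℚ
      t≡ k = cong (_* 1ℚ) (×ₙ≡ι* (0 C k) _)
      vanish : ∀ c x → c * (x * 0ℚ) * 1ℚ + 0ℚ ≡ x * 0ℚ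
      vanish = solve-∀ ℚ-ring
    aδ₁⋆𝟙 (suc n) = begin
      Σ< (2 ℕ.+ n) t
        ≡⟨ Σ<-suc (suc n) t ⟩
      t 0 + Σ< (suc n) (t ∘ suc)
        ≡⟨ cong (λ x → t 0 + x) (Σ<-suc n (t ∘ suc)) ⟩
      t 0 + (t 1 + Σ< n (t ∘ suc ∘ suc))
        ≡⟨ cong (λ x → t 0 + (t 1 + x)) (Σ<-vanishing n (t ∘ suc ∘ suc) (λ {k} _ → t[2+k]≡0 k)) ⟩
      t 0 + (t 1 + 0ℚ)
        ≡⟨ cong₂ (λ x y → x + (y + 0ℚ)) (t≡ 0) (t≡ 1) ⟩
      ι (+ 1) * (ι (+ a) * 0ℚ) * 1ℚ + (ι (+ (suc n C 1)) * (ι (+ a) * 1ℚ) * 1ℚ + 0ℚ)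
        ≡⟨ cong (λ c → ι (+ 1) * (ι (+ a) * 0ℚ) * 1ℚ + (ι (+ c) * (ι (+ a) * 1ℚ) * 1ℚ + 0ℚ)) (nC1≡n (suc n)) ⟩
      ι (+ 1) * (ι (+ a) * 0ℚ) * 1ℚ + (ι (+ suc n) * (ι (+ a) * 1ℚ) * 1ℚ + 0ℚ)
        ≡⟨ simplify (ι (+ 1)) (ι (+ a)) (ι (+ suc n)) ⟩
      ι (+ a) * ι (+ suc n) ∎
      where
      t : ℕ → ℚ
      t k = (suc n C k) ×ₙ (ι (+ a) * δ₁ k) * 1ℚ
      t≡ : ∀ k → t k ≡ ι (+ (suc n C k)) * (ι (+ a) * δ₁ k) * 1ℚ
      t≡ k = cong (_* 1ℚ) (×ₙ≡ι* (suc n C k) _)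
      t[2+k]≡0 : ∀ k → t (2 ℕ.+ k) ≡ 0ℚ
      t[2+k]≡0 k = trans (t≡ (2 ℕ.+ k)) (vanish (ι (+ (suc n C (2 ℕ.+ k)))) (ι (+ a)))
        where
        vanish : ∀ c x → c * (x * 0ℚ) * 1ℚ ≡ 0ℚ
        vanish = solve-∀ ℚ-ring
      simplify : ∀ c x m → c * (x * 0ℚ) * 1ℚ + (m * (x * 1ℚ) * 1ℚ + 0ℚ) ≡ x * m
      simplify = solve-∀ ℚ-ring

    -- The coefficients of G(t) (e^{at} − 1) = a t (e^t − 1).
    aδ₁+G⋆aᵏ≡an+G : ∀ n → ι (+ a) * δ₁ n + (Gₐ ⋆ aᵏ) n ≡ ι (+ a) * ι (+ n) + Gₐ n
    aδ₁+G⋆aᵏ≡an+G n = begin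
      ι (+ a) * δ₁ n + (Gₐ ⋆ aᵏ) n              ≡⟨ cong (_+ (Gₐ ⋆ aᵏ) n) (G-recurrence n) ⟨
      (Gₐ ⋆ s) n + (Gₐ ⋆ aᵏ) n                  ≡⟨ ⋆-distribˡ-+ Gₐ s aᵏ n ⟨
      (Gₐ ⋆ (λ k → s k + aᵏ k)) n               ≡⟨ ⋆-congʳ Gₐ (λ k → sym (s⋆𝟙+δ₀≡s+aᵏ k)) n ⟩
      (Gₐ ⋆ (λ k → (s ⋆ 𝟙) k + δ₀ k)) n         ≡⟨ ⋆-distribˡ-+ Gₐ (s ⋆ 𝟙) δ₀ n ⟩
      (Gₐ ⋆ (s ⋆ 𝟙)) n + (Gₐ ⋆ δ₀) n            ≡⟨ cong₂ _+_ (sym (⋆-assoc Gₐ s 𝟙 n)) (⋆-identityʳ Gₐ n) ⟩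
      ((Gₐ ⋆ s) ⋆ 𝟙) n + Gₐ n                   ≡⟨ cong (_+ Gₐ n) (⋆-congˡ 𝟙 G-recurrence n) ⟩
      ((λ k → ι (+ a) * δ₁ k) ⋆ 𝟙) n + Gₐ n     ≡⟨ cong (_+ Gₐ n) (aδ₁⋆𝟙 n) ⟩
      ι (+ a) * ι (+ n) + Gₐ n                  ∎

    summand : ℕ → ℕ → ℚ
    summand n k = (n C k) ×ₙ Gₐ k * aᵏ (n ∸ k)

    Σ-summand≡a*n : ∀ n → Σ< (2 ℕ.+ n) (summand (2 ℕ.+ n)) ≡ ι (+ a) * ι (+ (2 ℕ.+ n))
    Σ-summand≡a*n n = +-cancelʳ (Gₐ N) (Σ< N (summand N)) (ι (+ a) * ι (+ N)) (begin
      Σ< N (summand N) + Gₐ N                   ≡⟨ cong (λ x → Σ< N (summand N) + x) last-term ⟨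
      Σ< N (summand N) + summand N N            ≡⟨ Σ<-last N (summand N) ⟨
      (Gₐ ⋆ aᵏ) N                               ≡⟨ ℚ.+-identityˡ _ ⟨
      0ℚ + (Gₐ ⋆ aᵏ) N                          ≡⟨ cong (_+ (Gₐ ⋆ aᵏ) N) (ℚ.*-zeroʳ (ι (+ a))) ⟨
      ι (+ a) * δ₁ N + (Gₐ ⋆ aᵏ) N              ≡⟨ aδ₁+G⋆aᵏ≡an+G N ⟩
      ι (+ a) * ι (+ N) + Gₐ N                  ∎)
      where
      N : ℕ
      N = 2 ℕ.+ n
      last-term : summand N N ≡ Gₐ N
      last-term = begin
        (N C N) ×ₙ Gₐ N * aᵏ (N ∸ N) ≡⟨ cong₂ (λ c m → c ×ₙ Gₐ N * aᵏ m) (nCn≡1 N) (ℕ.n∸n≡0 N) ⟩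
        (Gₐ N + 0ℚ) * 1ℚ             ≡⟨ ℚ.*-identityʳ _ ⟩
        Gₐ N + 0ℚ                    ≡⟨ ℚ.+-identityʳ (Gₐ N) ⟩
        Gₐ N                         ∎

    aᵏ-suc : ∀ k → aᵏ (suc k) ≡ ι (+ a) * aᵏ k
    aᵏ-suc k = ι-pos-* a (a ℕ.^ k)

    summand-divisible : ∀ {n k} → 3 ℕ.+ k ≤ n → IsInt (Gₐ k) → (n ℕ.* (a ℕ.* a)) ∣[ a ] summand n k
    summand-divisible {n} {k} 3+k≤n Gₖ∈ℤ = conclude (binomial*power-divisible a 3+k≤n)
      where
      D : ℕ
      D = n ℕ.* (a ℕ.* a)
      swap : ∀ x y z → x * y * z ≡ x * z * y
      swap = solve-∀ ℚ-ring
      as-multiple : summand n k ≡ ι (+ ((n C k) ℕ.* a ℕ.^ (n ∸ k))) * Gₐ k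
      as-multiple = begin
        (n C k) ×ₙ Gₐ k * aᵏ (n ∸ k)              ≡⟨ cong (_* aᵏ (n ∸ k)) (×ₙ≡ι* (n C k) (Gₐ k)) ⟩
        ι (+ (n C k)) * Gₐ k * aᵏ (n ∸ k)         ≡⟨ swap (ι (+ (n C k))) (Gₐ k) (aᵏ (n ∸ k)) ⟩
        ι (+ (n C k)) * aᵏ (n ∸ k) * Gₐ k         ≡⟨ cong (_* Gₐ k) (ι-pos-* (n C k) (a ℕ.^ (n ∸ k))) ⟨
        ι (+ ((n C k) ℕ.* a ℕ.^ (n ∸ k))) * Gₐ k  ∎
      conclude : (∃₂ λ c r → ℕ.Coprime c a × c ℕ.* ((n C k) ℕ.* a ℕ.^ (n ∸ k)) ≡ D ℕ.* r) → D ∣[ a ] summand n k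
      conclude (c , r , c⊥a , eq) = subst (D ∣[ a ]_) (sym as-multiple) (∣[]-intro {D} {a} c⊥a eq Gₖ∈ℤ)

    lower-summands-divisible : ∀ m → (∀ {k} → k < suc m → IsInt (Gₐ k)) →
      ((3 ℕ.+ m) ℕ.* (a ℕ.* a)) ∣[ a ] Σ< (suc m) (summand (3 ℕ.+ m))
    lower-summands-divisible m IH =
      Σ<-closed (D ∣[ a ]_) (subst (D ∣[ a ]_)) (∣[]-0 {D} {a}) (∣[]-+ {D} {a}) (suc m)
      (λ k<1+m → summand-divisible (ℕ.+-monoʳ-≤ 3 (ℕ.≤-pred k<1+m)) (IH k<1+m))
      where
      D : ℕ
      D = (3 ℕ.+ m) ℕ.* (a ℕ.* a)

    Σ-summand-split : ∀ m →
      Σ< (suc m) (summand (3 ℕ.+ m)) + ι (+ ((3 ℕ.+ m) C suc m)) * Gₐ (suc m) * (ι (+ a) * ι (+ a))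
        + ι (+ (3 ℕ.+ m)) * Gₐ (2 ℕ.+ m) * ι (+ a) ≡ ι (+ a) * ι (+ (3 ℕ.+ m))
    Σ-summand-split m = begin
      Σ< (suc m) t + K * G′ * (A * A) + N * Gₘ * A ≡⟨ cong₂ (λ x y → Σ< (suc m) t + x + y) t[1+m] t[2+m] ⟨
      Σ< (suc m) t + t (suc m) + t (2 ℕ.+ m)       ≡⟨ cong (_+ t (2 ℕ.+ m)) (Σ<-last (suc m) t) ⟨
      Σ< (2 ℕ.+ m) t + t (2 ℕ.+ m)                 ≡⟨ Σ<-last (2 ℕ.+ m) t ⟨
      Σ< (3 ℕ.+ m) t                               ≡⟨ Σ-summand≡a*n (suc m) ⟩
      A * N                                        ∎
      where
      t = summand (3 ℕ.+ m)
      A N K Gₘ G′ : ℚ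
      A = ι (+ a)
      N = ι (+ (3 ℕ.+ m))
      K = ι (+ ((3 ℕ.+ m) C suc m))
      Gₘ = Gₐ (2 ℕ.+ m)
      G′ = Gₐ (suc m)
      t[1+m] : t (suc m) ≡ K * G′ * (A * A)
      t[1+m] = begin
        ((3 ℕ.+ m) C suc m) ×ₙ G′ * aᵏ (3 ℕ.+ m ∸ suc m)
          ≡⟨ cong₂ _*_ (×ₙ≡ι* ((3 ℕ.+ m) C suc m) G′) (cong aᵏ (ℕ.m+n∸n≡m 2 m)) ⟩
        K * G′ * aᵏ 2
          ≡⟨ cong (K * G′ *_) (trans (aᵏ-suc 1) (cong (A *_) (trans (aᵏ-suc 0) (ℚ.*-identityʳ A)))) ⟩
        K * G′ * (A * A)                                 ∎
      t[2+m] : t (2 ℕ.+ m) ≡ N * Gₘ * A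
      t[2+m] = begin
        ((3 ℕ.+ m) C (2 ℕ.+ m)) ×ₙ Gₘ * aᵏ (3 ℕ.+ m ∸ (2 ℕ.+ m))
          ≡⟨ cong₂ _*_ (×ₙ≡ι* ((3 ℕ.+ m) C (2 ℕ.+ m)) Gₘ) (cong aᵏ (ℕ.m+n∸n≡m 1 (2 ℕ.+ m))) ⟩
        ι (+ ((3 ℕ.+ m) C (2 ℕ.+ m))) * Gₘ * aᵏ 1
          ≡⟨ cong₂ (λ c x → ι (+ c) * Gₘ * x) ([1+n]Cn≡1+n (2 ℕ.+ m)) (trans (aᵏ-suc 0) (ℚ.*-identityʳ A)) ⟩
        N * Gₘ * A                                                ∎

    -- Multiply the split identity by 2c, where c clears the lower summands, and divide by (m + 3) a.
    local-relation : ∀ m → (∀ {k} → k < 2 ℕ.+ m → IsInt (Gₐ k)) →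
      (2 ℕ.* a) ∣[ a ] (ι (+ 2) * (Gₐ (2 ℕ.+ m) - 1ℚ) + ι (+ a) * ι (+ (2 ℕ.+ m)) * Gₐ (suc m))
    local-relation m IH = conclude (lower-summands-divisible m (IH ∘ ℕ.m<n⇒m<1+n))
      where
      n : ℕ
      n = 3 ℕ.+ m
      T A N M K Gₘ G′ two : ℚ
      T = Σ< (suc m) (summand n)
      A = ι (+ a)
      N = ι (+ n)
      M = ι (+ (2 ℕ.+ m))
      K = ι (+ (n C suc m))
      Gₘ = Gₐ (2 ℕ.+ m)
      G′ = Gₐ (suc m)
      two = ι (+ 2)

      K*2≡N*M : K * two ≡ N * M
      K*2≡N*M = trans (sym (ι-pos-* (n C suc m) 2))
                      (trans (cong (ι ∘ +_) ([2+n]Cn*2≡[2+n]*[1+n] (suc m))) (ι-pos-* n (2 ℕ.+ m)))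

      N*A≢0 : ℚ.NonZero (N * A)
      N*A≢0 = subst ℚ.NonZero (ι-pos-* n a) (ι-nonZero (n ℕ.* a))

      cong₃ : ∀ {X Y Z W : Set} (f : X → Y → Z → W) {x x′ y y′ z z′} →
              x ≡ x′ → y ≡ y′ → z ≡ z′ → f x y z ≡ f x′ y′ z′
      cong₃ f refl refl refl = refl

      -- The three brackets on the right vanish by Σ-summand-split, cT≡NAAw and K*2≡N*M.
      expand : ∀ c G G′ A N M K T W two →
        c * (two * (G - 1ℚ) + A * M * G′) * (N * A) ≡
        two * c * ((T + K * G′ * (A * A) + N * G * A) - A * N) - two * (c * T - N * (A * A) * W)
          + c * (A * A) * G′ * (N * M - K * two) + two * A * (- W) * (N * A)
      expand = solve-∀ ℚ-ring

      vanish : ∀ two c x y z u r → two * c * (x - x) - two * (y - y) + z * (u - u) + r ≡ r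
      vanish = solve-∀ ℚ-ring

      conclude : (n ℕ.* (a ℕ.* a)) ∣[ a ] T → (2 ℕ.* a) ∣[ a ] (two * (Gₘ - 1ℚ) + A * M * G′)
      conclude (c , w , c⊥a , cT≡Dw) = c , ℤ.- w , c⊥a , *-cancelʳ-≡ (N * A) {{N*A≢0}} (begin
        γ * (two * (Gₘ - 1ℚ) + A * M * G′) * (N * A)
          ≡⟨ expand γ Gₘ G′ A N M K T (ι w) two ⟩
        two * γ * ((T + K * G′ * (A * A) + N * Gₘ * A) - A * N) - two * (γ * T - N * (A * A) * ι w)
          + γ * (A * A) * G′ * (N * M - K * two) + two * A * (- ι w) * (N * A)
          ≡⟨ cong₃ (λ x y z → two * γ * (x - A * N) - two * (y - N * (A * A) * ι w)
                              + γ * (A * A) * G′ * (N * M - z) + two * A * (- ι w) * (N * A))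
                   (Σ-summand-split m) cT≡NAAw K*2≡N*M ⟩
        two * γ * (A * N - A * N) - two * (N * (A * A) * ι w - N * (A * A) * ι w)
          + γ * (A * A) * G′ * (N * M - N * M) + two * A * (- ι w) * (N * A)
          ≡⟨ vanish two γ (A * N) (N * (A * A) * ι w) (γ * (A * A) * G′) (N * M) _ ⟩
        two * A * (- ι w) * (N * A)
          ≡⟨ cong₂ (λ x y → x * y * (N * A)) (ι-pos-* 2 a) (ι-homo‿- w) ⟨
        ι (+ (2 ℕ.* a)) * ι (ℤ.- w) * (N * A) ∎)
        where
        γ : ℚ
        γ = ι (+ c)
        cT≡NAAw : γ * T ≡ N * (A * A) * ι w
        cT≡NAAw = trans cT≡Dw (cong (_* ι w) (trans (ι-pos-* n (a ℕ.* a)) (cong (N *_) (ι-pos-* a a))))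

    local-congruence-odd : ℕ.Coprime 2 a → ∀ m → IsInt (Gₐ (suc m)) →
      (2 ℕ.* a) ∣[ a ] (ι (+ 2) * (Gₐ (2 ℕ.+ m) - 1ℚ) + ι (+ a) * ι (+ (2 ℕ.+ m)) * Gₐ (suc m)) →
      a ∣[ a ] (Gₐ (2 ℕ.+ m) - 1ℚ + ι (+ ((2 ℕ.+ m) ℕ.* 0)) * Gₐ (suc m))
    local-congruence-odd 2⊥a m (g′ , G′≡g′) (c , q , c⊥a , cX≡2aq) =
      2 ℕ.* c , + 2 ℤ.* q ℤ.- + c ℤ.* + (2 ℕ.+ m) ℤ.* g′ , coprime-* 2⊥a c⊥a , (begin
        ι (+ (2 ℕ.* c)) * (Gₘ - 1ℚ + ι (+ ((2 ℕ.+ m) ℕ.* 0)) * G′)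
          ≡⟨ cong₂ (λ x y → x * (Gₘ - 1ℚ + ι (+ y) * G′)) (ι-pos-* 2 c) (ℕ.*-zeroʳ (2 ℕ.+ m)) ⟩
        two * γ * (Gₘ - 1ℚ + 0ℚ * G′)        ≡⟨ split-off γ Gₘ G′ A M two ⟩
        γ * X - A * (γ * M * G′)             ≡⟨ cong (λ x → x - A * (γ * M * G′)) cX≡2aq ⟩
        ι (+ (2 ℕ.* a)) * ι q - A * (γ * M * G′)
          ≡⟨ cong₂ (λ x y → x * ι q - A * (γ * M * y)) (ι-pos-* 2 a) G′≡g′ ⟩
        two * A * ι q - A * (γ * M * ι g′)   ≡⟨ factor A two γ M (ι q) (ι g′) ⟩
        A * (two * ι q - γ * M * ι g′)       ≡⟨ cong (A *_) ι-combination ⟨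
        A * ι (+ 2 ℤ.* q ℤ.- + c ℤ.* + (2 ℕ.+ m) ℤ.* g′) ∎)
      where
      A M Gₘ G′ two X γ : ℚ
      A = ι (+ a)
      M = ι (+ (2 ℕ.+ m))
      Gₘ = Gₐ (2 ℕ.+ m)
      G′ = Gₐ (suc m)
      two = ι (+ 2)
      X = two * (Gₘ - 1ℚ) + A * M * G′
      γ = ι (+ c)
      ι-combination : ι (+ 2 ℤ.* q ℤ.- + c ℤ.* + (2 ℕ.+ m) ℤ.* g′) ≡ two * ι q - γ * M * ι g′
      ι-combination = trans (ι-homo-- (+ 2 ℤ.* q) (+ c ℤ.* + (2 ℕ.+ m) ℤ.* g′)) (cong₂ _-_ (ι-homo-* (+ 2) q)
        (trans (ι-homo-* (+ c ℤ.* + (2 ℕ.+ m)) g′) (cong (_* ι g′) (ι-homo-* (+ c) (+ (2 ℕ.+ m))))))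
      split-off : ∀ γ G G′ A M two → two * γ * (G - 1ℚ + 0ℚ * G′) ≡ γ * (two * (G - 1ℚ) + A * M * G′) - A * (γ * M * G′)
      split-off = solve-∀ ℚ-ring
      factor : ∀ A two γ M Q g → two * A * Q - A * (γ * M * g) ≡ A * (two * Q - γ * M * g)
      factor = solve-∀ ℚ-ring

    local-congruence-even : ∀ h → a ≡ h ℕ.* 2 → ∀ m →
      (2 ℕ.* a) ∣[ a ] (ι (+ 2) * (Gₐ (2 ℕ.+ m) - 1ℚ) + ι (+ a) * ι (+ (2 ℕ.+ m)) * Gₐ (suc m)) →
      a ∣[ a ] (Gₐ (2 ℕ.+ m) - 1ℚ + ι (+ ((2 ℕ.+ m) ℕ.* h)) * Gₐ (suc m))
    local-congruence-even h a≡h*2 m (c , q , c⊥a , cX≡2aq) =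
      c , q , c⊥a , *-cancelʳ-≡ two {{ι-nonZero 2}} (begin
        γ * (Gₘ - 1ℚ + ι (+ ((2 ℕ.+ m) ℕ.* h)) * G′) * two
          ≡⟨ cong (λ x → γ * (Gₘ - 1ℚ + x * G′) * two) (ι-pos-* (2 ℕ.+ m) h) ⟩
        γ * (Gₘ - 1ℚ + M * H * G′) * two
          ≡⟨ expand γ Gₘ G′ M H two ⟩
        γ * (two * (Gₘ - 1ℚ) + H * two * M * G′)
          ≡⟨ cong (λ x → γ * (two * (Gₘ - 1ℚ) + x * M * G′)) A≡H*2 ⟨
        γ * (two * (Gₘ - 1ℚ) + A * M * G′)
          ≡⟨ cX≡2aq ⟩
        ι (+ (2 ℕ.* a)) * ι q
          ≡⟨ cong (_* ι q) (ι-pos-* 2 a) ⟩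
        two * A * ι q
          ≡⟨ rotate two A (ι q) ⟩
        A * ι q * two                                      ∎)
      where
      A H M Gₘ G′ two γ : ℚ
      A = ι (+ a)
      H = ι (+ h)
      M = ι (+ (2 ℕ.+ m))
      Gₘ = Gₐ (2 ℕ.+ m)
      G′ = Gₐ (suc m)
      two = ι (+ 2)
      γ = ι (+ c)
      A≡H*2 : A ≡ H * two
      A≡H*2 = trans (cong (ι ∘ +_) a≡h*2) (ι-pos-* h 2)
      expand : ∀ γ G G′ M H two → γ * (G - 1ℚ + M * H * G′) * two ≡ γ * (two * (G - 1ℚ) + H * two * M * G′)
      expand = solve-∀ ℚ-ring
      rotate : ∀ x y z → x * y * z ≡ y * z * x
      rotate = solve-∀ ℚ-ring

    local-congruence : (p : Parity a) → ∀ m → (∀ {k} → k < 2 ℕ.+ m → IsInt (Gₐ k)) →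
      a ∣[ a ] (Gₐ (2 ℕ.+ m) - 1ℚ + ι (+ ((2 ℕ.+ m) ℕ.* half p)) * Gₐ (suc m))
    local-congruence (odd 2⊥a)      m IH = local-congruence-odd 2⊥a m (IH (ℕ.n<1+n (suc m))) (local-relation m IH)
    local-congruence (even h a≡h*2) m IH = local-congruence-even h a≡h*2 m (local-relation m IH)

    IsInt-δ₁ : ∀ n → IsInt (δ₁ n)
    IsInt-δ₁ 0             = + 0 , refl
    IsInt-δ₁ 1             = + 1 , refl
    IsInt-δ₁ (suc (suc n)) = + 0 , refl

    IsInt-a*G : ∀ n → (∀ {k} → k < n → IsInt (Gₐ k)) → IsInt (ι (+ a) * Gₐ n)
    IsInt-a*G n IH = subst IsInt aG≡ (IsInt-- (IsInt-* (+ a , refl) (IsInt-δ₁ n)) Σ∈ℤ)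
      where
      Σt : ℚ
      Σt = Σ< n (λ k → (n C k) ×ₙ Gₐ k * s (n ∸ k))
      Σ∈ℤ : IsInt Σt
      Σ∈ℤ = Σ<-closed IsInt (subst IsInt) (+ 0 , refl) IsInt-+ n
        (λ {k} k<n → subst IsInt (sym (cong (_* s (n ∸ k)) (×ₙ≡ι* (n C k) (Gₐ k))))
                       (IsInt-* (IsInt-* (+ (n C k) , refl) (IH k<n)) (+ powSum a (n ∸ k) , refl)))
      aG≡ : ι (+ a) * δ₁ n - Σt ≡ ι (+ a) * Gₐ n
      aG≡ = begin
        ι (+ a) * δ₁ n - Σt                  ≡⟨ cong (_- Σt) (G-recurrence′ n) ⟨
        Σt + Gₐ n * ι (+ a) - Σt             ≡⟨ cancel Σt (Gₐ n) (ι (+ a)) ⟩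
        ι (+ a) * Gₐ n                       ∎
        where
        cancel : ∀ S G A → S + G * A - S ≡ A * G
        cancel = solve-∀ ℚ-ring

    G₀≡0 : Gₐ 0 ≡ ι (+ 0)
    G₀≡0 = begin
      Gₐ 0                                               ≡⟨ G-unfold 0 ⟩
      0ℚ - Σ< 0 (λ k → ι (+ (0 C k)) * Gₐ k * s (0 ∸ k)) * ((+ 1) / a) ≡⟨ cong (λ x → 0ℚ - x * ((+ 1) / a)) (Σ<-empty _) ⟩
      0ℚ - 0ℚ * ((+ 1) / a)                              ≡⟨ vanish ((+ 1) / a) ⟩
      0ℚ                                                 ∎
      where
      vanish : ∀ r → 0ℚ - 0ℚ * r ≡ 0ℚ
      vanish = solve-∀ ℚ-ring

    G₁≡1 : Gₐ 1 ≡ ι (+ 1)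
    G₁≡1 = begin
      Gₐ 1
        ≡⟨ G-unfold 1 ⟩
      1ℚ - Σ< 1 t * r
        ≡⟨ cong (λ x → 1ℚ - x * r) (Σ<-suc 0 t) ⟩
      1ℚ - (t 0 + Σ< 0 (t ∘ suc)) * r
        ≡⟨ cong₂ (λ x y → 1ℚ - (ι (+ 1) * x * s 1 + y) * r) G₀≡0 (Σ<-empty _) ⟩
      1ℚ - (ι (+ 1) * 0ℚ * s 1 + 0ℚ) * r
        ≡⟨ vanish (ι (+ 1)) (s 1) r ⟩
      1ℚ                                                 ∎
      where
      r : ℚ
      r = (+ 1) / a
      t : ℕ → ℚ
      t k = ι (+ (1 C k)) * Gₐ k * s (1 ∸ k)
      vanish : ∀ c x r → 1ℚ - (c * 0ℚ * x + 0ℚ) * r ≡ 1ℚ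
      vanish = solve-∀ ℚ-ring

    G-integral : Parity a → ∀ n → IsInt (Gₐ n)
    G-integral p = <-rec (IsInt ∘ Gₐ) step
      where
      step : ∀ n → (∀ {k} → k < n → IsInt (Gₐ k)) → IsInt (Gₐ n)
      step 0             _  = + 0 , G₀≡0
      step 1             _  = + 1 , G₁≡1
      step (suc (suc m)) IH = IsInt-from-local {a}
        (subst (a ∣[ a ]_) (regroup (Gₐ (2 ℕ.+ m)) E (Gₐ (suc m))) (local-congruence p m IH))
        (IsInt-- (+ 1 , refl) (IsInt-* (+ ((2 ℕ.+ m) ℕ.* half p) , refl) (IH (ℕ.n<1+n (suc m)))))
        (IsInt-a*G (2 ℕ.+ m) IH)
        where
        E : ℚ
        E = ι (+ ((2 ℕ.+ m) ℕ.* half p))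
        regroup : ∀ G E G′ → G - 1ℚ + E * G′ ≡ G - (1ℚ - E * G′)
        regroup = solve-∀ ℚ-ring

    -- Opaque, as unfolding g would run the well-founded recursion of G-integral during type checking.
    opaque
      g : Parity a → ℕ → ℤ
      g p n = proj₁ (G-integral p n)

      G≡ιg : ∀ p n → Gₐ n ≡ ι (g p n)
      G≡ιg p n = proj₂ (G-integral p n)

    g-congruence : (p : Parity a) → ∀ m →
      + a ∣ g p (2 ℕ.+ m) ℤ.- + 1 ℤ.+ + ((2 ℕ.+ m) ℕ.* half p) ℤ.* g p (suc m)
    g-congruence p m = ∣[]⇒∣ {a} {g p (2 ℕ.+ m) ℤ.- + 1 ℤ.+ E ℤ.* g p (suc m)}
      (subst (a ∣[ a ]_) as-ι (local-congruence p m (λ {k} _ → G-integral p k)))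
      where
      E : ℤ
      E = + ((2 ℕ.+ m) ℕ.* half p)
      as-ι : Gₐ (2 ℕ.+ m) - 1ℚ + ι E * Gₐ (suc m) ≡ ι (g p (2 ℕ.+ m) ℤ.- + 1 ℤ.+ E ℤ.* g p (suc m))
      as-ι = begin
        Gₐ (2 ℕ.+ m) - 1ℚ + ι E * Gₐ (suc m)
          ≡⟨ cong₂ (λ x y → x - 1ℚ + ι E * y) (G≡ιg p (2 ℕ.+ m)) (G≡ιg p (suc m)) ⟩
        ι (g p (2 ℕ.+ m)) - ι (+ 1) + ι E * ι (g p (suc m))
          ≡⟨ cong₂ _+_ (ι-homo-- (g p (2 ℕ.+ m)) (+ 1)) (ι-homo-* E (g p (suc m))) ⟨
        ι (g p (2 ℕ.+ m) ℤ.- + 1) + ι (E ℤ.* g p (suc m))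
          ≡⟨ ι-homo-+ (g p (2 ℕ.+ m) ℤ.- + 1) (E ℤ.* g p (suc m)) ⟨
        ι (g p (2 ℕ.+ m) ℤ.- + 1 ℤ.+ E ℤ.* g p (suc m)) ∎

    g₁≡1 : ∀ p → g p 1 ≡ + 1
    g₁≡1 p = ι-injective (trans (sym (G≡ιg p 1)) G₁≡1)

    g-congruence-odd : (2⊥a : ℕ.Coprime 2 a) → ∀ m → + a ∣ g (odd 2⊥a) (2 ℕ.+ m) ℤ.- + 1
    g-congruence-odd 2⊥a m = subst (+ a ∣_) drop (g-congruence (odd 2⊥a) m)
      where
      x y : ℤ
      x = g (odd 2⊥a) (2 ℕ.+ m) ℤ.- + 1
      y = g (odd 2⊥a) (suc m)
      drop : x ℤ.+ + ((2 ℕ.+ m) ℕ.* 0) ℤ.* y ≡ x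
      drop = begin
        x ℤ.+ + ((2 ℕ.+ m) ℕ.* 0) ℤ.* y   ≡⟨ cong (λ k → x ℤ.+ + k ℤ.* y) (ℕ.*-zeroʳ (2 ℕ.+ m)) ⟩
        x ℤ.+ + 0 ℤ.* y                   ≡⟨ ℤ.+-identityʳ x ⟩
        x                                 ∎

    g-congruence-even : ∀ h (a≡h*2 : a ≡ h ℕ.* 2) m → + a ∣ g (even h a≡h*2) (2 ℕ.+ m) ℤ.- + 1 ℤ.+ + ((2 ℕ.+ m) ℕ.* h)
    g-congruence-even h a≡h*2 zero = subst (λ z → + a ∣ g p 2 ℤ.- + 1 ℤ.+ z)
      (trans (cong (+ (2 ℕ.* h) ℤ.*_) (g₁≡1 p)) (ℤ.*-identityʳ (+ (2 ℕ.* h)))) (g-congruence p 0)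
      where p = even h a≡h*2
    g-congruence-even h a≡h*2 (suc m) =
      ∣-drop-factor h m (g p (3 ℕ.+ m)) (g p (2 ℕ.+ m)) a≡h*2 (g-congruence p (suc m)) (g-congruence-even h a≡h*2 m)
      where p = even h a≡h*2

    genocchi-odd : ¬ 2 ℕ.∣ a → ∀ n → 1 ≤ n → ∃ λ z → G n a ≡ ι z × + a ∣ z ℤ.- + 1
    genocchi-odd 2∤a 1             _ = + 1 , G₁≡1 , a ℕ.∣0
    genocchi-odd 2∤a (suc (suc m)) _ = g p (2 ℕ.+ m) , G≡ιg p (2 ℕ.+ m) , g-congruence-odd 2⊥a m
      where
      2⊥a : ℕ.Coprime 2 a
      2⊥a = ∤⇒coprime-2 2∤a
      p : Parity a
      p = odd 2⊥a

    module _ {h} (a≡h*2 : a ≡ h ℕ.* 2) where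

      genocchi-even-even : ∀ n → 2 ≤ n → 2 ℕ.∣ n → ∃ λ z → G n a ≡ ι z × + a ∣ z ℤ.- + 1
      genocchi-even-even (suc (suc m)) (s≤s (s≤s z≤n)) (ℕ.divides q n≡q*2) = g p (2 ℕ.+ m) , G≡ιg p (2 ℕ.+ m) ,
        ∣-even-multiple h q (g p (2 ℕ.+ m)) a≡h*2 n≡q*2 (g-congruence-even h a≡h*2 m)
        where p = even h a≡h*2

      genocchi-even-odd : ∀ n → 2 ≤ n → ¬ 2 ℕ.∣ n → ∃ λ z → G n a ≡ ι z × + a ∣ z ℤ.- (+ 1 ℤ.+ + h)
      genocchi-even-odd (suc (suc m)) (s≤s (s≤s z≤n)) 2∤n = g p (2 ℕ.+ m) , G≡ιg p (2 ℕ.+ m) ,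
        ∣-odd-multiple h (proj₁ (∤2⇒≡1+q*2 2∤n)) (g p (2 ℕ.+ m)) a≡h*2 (proj₂ (∤2⇒≡1+q*2 2∤n))
          (g-congruence-even h a≡h*2 m)
        where p = even h a≡h*2

open import Data.Nat using (ℕ; _≤_; _/_)
open import Data.Nat.Divisibility using () renaming (_∣_ to _∣ℕ_)
open import Data.Integer using (ℤ; +_; _-_; _+_)
open import Data.Integer.Divisibility using (_∣_)
open import Data.Rational using () renaming (_/_ to _/ℚ_)
open import Data.Product using (∃; _×_)
open import Relation.Binary.PropositionalEquality using (_≡_)
open import Relation.Nullary using (¬_)
open import Data.Nat.Divisibility using (divides)
open import Data.Nat.DivMod using (m*n/n≡m)
open import Relation.Binary.PropositionalEquality using (sym; trans; cong; subst)

corollary2p4 : (a : ℕ) → 2 ≤ a →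
    (¬ (2 ∣ℕ a) → (n : ℕ) → 1 ≤ n →
        ∃ λ (g : ℤ) → G n a ≡ g /ℚ 1 × (+ a) ∣ (g - + 1))
    × (2 ∣ℕ a → (n : ℕ) → 2 ≤ n →
        ((2 ∣ℕ n → ∃ λ (g : ℤ) → G n a ≡ g /ℚ 1 × (+ a) ∣ (g - + 1))
        × (¬ (2 ∣ℕ n) → ∃ λ (g : ℤ) → G n a ≡ g /ℚ 1 × (+ a) ∣ (g - (+ 1 + + (a / 2))))))
corollary2p4 (suc b) _ = genocchi-odd , even-case
  where
  open Genocchi b
  even-case : 2 ∣ℕ a → (n : ℕ) → 2 ≤ n →
    (2 ∣ℕ n → ∃ λ z → G n a ≡ ι z × (+ a) ∣ (z - + 1))
    × (¬ (2 ∣ℕ n) → ∃ λ z → G n a ≡ ι z × (+ a) ∣ (z - (+ 1 + + (a / 2))))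
  even-case (divides h a≡h*2) n 2≤n =
    genocchi-even-even {h} a≡h*2 n 2≤n ,
    subst (λ e → ¬ (2 ∣ℕ n) → ∃ λ z → G n a ≡ ι z × (+ a) ∣ (z - (+ 1 + + e)))
      (sym a/2≡h) (genocchi-even-odd {h} a≡h*2 n 2≤n)
    where
    a/2≡h : a / 2 ≡ h
    a/2≡h = trans (cong (_/ 2) a≡h*2) (m*n/n≡m h 2)
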